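{- Let $p$ be a prime, $q$ a power of $p$, and $n\ge 1$ an integer. Let $a_n\in\mathbb{F}_p$ be defined by the power series identity $\sum_{n\ge 0}a_n t^n=\dfrac{ -t^{q-1}}{1-t^{q-1}-t^q}$ in $\mathbb{F}_p[[t]]$. (i) If $q>2$, then $g_{n,q}$ is a permutation polynomial of $\mathbb{F}_q$ if and only if $\gcd(n,q-1)=1$ and $a_n\ne 0$ in $\mathbb{F}_p$. (ii) If $q=2$, then $g_{n,2}$ is a permutation polynomial of $\mathbb{F}_2$ if and only if $a_n=0$ in $\mathbb{F}_2$.
   Context: For a prime $p$, a power $q$ of $p$ and an integer $n\ge 0$, $g_{n,q}\in\mathbb{F}_p[x]$ denotes the unique polynomial satisfying $\sum_{a\in\mathbb{F}_q}(x+a)^n=g_{n,q}(x^q-x)$. A polynomial $f$ is a permutation polynomial (PP) of a finite field $\mathbb{F}$ if $c\mapsto f(c)$ is a bijection of $\mathbb{F}$. -}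

module Defs where

open import Level using (Level; _⊔_)
open import Algebra.Bundles using (CommutativeRing)
open import Data.Nat as ℕ using (ℕ; zero; suc; _∸_; _≡ᵇ_)
open import Data.Fin using (Fin)
open import Data.List using (List; []; _∷_; foldr; map; replicate)
open import Data.List.Base using (allFin)
open import Data.Bool using (if_then_else_)
open import Data.Product using (Σ; _×_)
open import Relation.Nullary using (¬_)
open import Relation.Binary.PropositionalEquality using (_≡_)

record FiniteField (c ℓ : Level) (q : ℕ) : Set (Level.suc (c ⊔ ℓ)) where
  field
    commRing : CommutativeRing c ℓ
  open CommutativeRing commRing public
  field
    1≉0      : ¬ (1# ≈ 0#)
    inverse  : ∀ x → ¬ (x ≈ 0#) → Σ Carrier (λ y → (x * y) ≈ 1#)
    enum     : Fin q → Carrier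
    enum-inj : ∀ i j → enum i ≈ enum j → i ≡ j
    enum-sur : ∀ x → Σ (Fin q) (λ i → enum i ≈ x)

module _ {c ℓ : Level} {q : ℕ} (F : FiniteField c ℓ q) where
  open FiniteField F using (Carrier; _≈_; _+_; _*_; -_; 0#; 1#; enum)

  -- Polynomials over F: coefficient lists, lowest degree first.

  Poly : Set c
  Poly = List Carrier

  coeff : Poly → ℕ → Carrier
  coeff []       _       = 0#
  coeff (a ∷ _)  zero    = a
  coeff (_ ∷ as) (suc i) = coeff as i

  -- equality of polynomials (coefficientwise; trailing zeros irrelevant)
  _≋_ : Poly → Poly → Set ℓ
  P ≋ Q = ∀ i → coeff P i ≈ coeff Q i

  _+ₚ_ : Poly → Poly → Poly
  []       +ₚ Q        = Q
  (a ∷ P)  +ₚ []       = a ∷ P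
  (a ∷ P)  +ₚ (b ∷ Q)  = (a + b) ∷ (P +ₚ Q)

  negₚ : Poly → Poly
  negₚ = map (-_)

  scale : Carrier → Poly → Poly
  scale a = map (a *_)

  _*ₚ_ : Poly → Poly → Poly
  []      *ₚ Q = []
  (a ∷ P) *ₚ Q = scale a Q +ₚ (0# ∷ (P *ₚ Q))

  constₚ : Carrier → Poly
  constₚ a = a ∷ []

  Xₚ : Poly
  Xₚ = 0# ∷ 1# ∷ []

  _^ₚ_ : Poly → ℕ → Poly
  P ^ₚ zero  = 1# ∷ []
  P ^ₚ suc n = P *ₚ (P ^ₚ n)

  compose : Poly → Poly → Poly
  compose G H = foldr (λ a acc → constₚ a +ₚ (H *ₚ acc)) [] G

  eval : Poly → Carrier → Carrier
  eval G x = foldr (λ a acc → a + (x * acc)) 0# G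

  elements : List Carrier
  elements = map enum (allFin q)

  sumₚ : List Poly → Poly
  sumₚ = foldr _+ₚ_ []

  -- G is g_{n,q}:  Σ_{a ∈ F_q} (x + a)^n = G(x^q - x)  in F_q[x].
  -- (g_{n,q} ∈ F_p[x] ⊆ F_q[x]; such a G is unique.)

  IsG : ℕ → Poly → Set ℓ
  IsG n G = sumₚ (map (λ a → (Xₚ +ₚ constₚ a) ^ₚ n) elements)
            ≋ compose G ((Xₚ ^ₚ q) +ₚ negₚ Xₚ)

  IsPP : Poly → Set (c ⊔ ℓ)
  IsPP G = (∀ x y → eval G x ≈ eval G y → x ≈ y)
         × (∀ y → Σ Carrier (λ x → eval G x ≈ y))

  -- Coefficients a_n of  -t^{q-1} / (1 - t^{q-1} - t^q), computed in
  -- the prime field F_p ⊆ F.  From a(t)(1 - t^{q-1} - t^q) = -t^{q-1}: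
  --   a_m = -[m = q-1] + a_{m-(q-1)} + a_{m-q}   (a_j = 0 for j < 0),
  -- valid since q ≥ 2.
  -- history m = [a_m, a_{m-1}, ..., a_0].

  private
    get : List Carrier → ℕ → Carrier
    get = coeff

    indicator : ℕ → Carrier
    indicator m = if m ≡ᵇ (q ∸ 1) then - 1# else 0#

  history : ℕ → List Carrier
  history zero    = indicator zero ∷ []
  history (suc m) = (indicator (suc m) + (get h (q ∸ 2) + get h (q ∸ 1))) ∷ h
    where h = history m

  seriesCoeff : ℕ → Carrier
  seriesCoeff m = get (history m) 0

-- Write S n = ∑_{a ∈ F} (X + a)ⁿ and H = X^q - X. Since (X + a)^q = X + a + H, the sums satisfy
-- S (q + m) = S (m + 1) + H · S m, the same recursion as the coefficients a_n of
-- -t^(q-1) / (1 - t^(q-1) - t^q); for n < q, S n is the constant power sum σ n = ∑_{x ∈ F} xⁿ, which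
-- vanishes below q - 1 and is -1 at q - 1. Running the recursion on g_{n,q} (with g(H) = S n, so
-- g_{q+m} = g_{m+1} + X g_m) gives g_{n,q}(y) = a_n yⁿ on the units y, and g_{n,q}(0) = 0 or -1
-- according as q - 1 ∤ n or q - 1 ∣ n. For q > 2, y ↦ a_n yⁿ (extended by 0) permutes F iff a_n ≠ 0
-- and gcd(n, q - 1) = 1: if d = gcd(n, q - 1) > 1, the power sum ∑ g(y)^((q-1)/d) is 0 for a
-- permutation but -a_n^((q-1)/d) here. For q = 2, g(0) = 1 and g(1) = a_n.

module Submission where

open import Level using (_⊔_)
open import Algebra.Bundles using (CommutativeMonoid; AbelianGroup)
import Algebra.Properties.CommutativeMonoid.Sum as MonoidSum
open import Data.Bool using (Bool; true; false; if_then_else_)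
open import Data.Empty using (⊥-elim)
open import Data.Fin as Fin using (Fin)
import Data.Fin.Permutation as Permutation
import Data.Fin.Properties as Fin
open import Data.List as List using (List; []; _∷_; length)
import Data.List.Properties as List
open import Data.List.Relation.Unary.All as All using (All; []; _∷_)
open import Data.List.Relation.Unary.AllPairs using (AllPairs; []; _∷_)
import Data.List.Relation.Unary.AllPairs.Properties as AllPairs
open import Data.Nat as ℕ using (ℕ; zero; suc; _≤_; _<_; _∸_; z≤n; s≤s)
import Data.Nat.Properties as ℕ
open import Data.Nat.Coprimality using (coprime-Bézout; gcd≡1⇒coprime)
open import Data.Nat.Divisibility using (_∣_; divides; ∣⇒≤; n∣n; ∣m+n∣m⇒∣n; ∣m∣n⇒∣m+n; 1∣_; ∣1⇒≡1)
open import Data.Nat.GCD using (gcd; gcd[m,n]∣m; gcd[m,n]∣n; gcd-greatest; module Bézout)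
open import Data.Nat.Induction using (<-rec)
open import Data.Nat.Primality using (Prime; prime⇒nonTrivial)
open import Data.Product using (Σ; _×_; _,_; proj₁; proj₂)
open import Data.Sum using (_⊎_; inj₁; inj₂)
open import Defs using (FiniteField; Poly; IsG; IsPP; seriesCoeff)
open import Function using (_∘_)
open import Function.Bundles using (_⇔_; mk⇔)
open import Relation.Binary using (Setoid; Decidable)
open import Relation.Binary.PropositionalEquality as ≡ using (_≡_; _≢_)
import Relation.Binary.Reasoning.Setoid as SetoidReasoning
open import Relation.Nullary using (¬_; yes; no)

module FieldProperties {c ℓ q} (F : FiniteField c ℓ q) where
  open FiniteField F
  open import Algebra.Properties.Ring ring public
    using (x∙y⁻¹≈ε⇒x≈y; -0#≈0#; -‿involutive; -1*x≈-x; +-identityˡ-unique; +-identityʳ-unique; +-inverseʳ-unique)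
  open import Algebra.Properties.CommutativeSemiring.Exp commutativeSemiring public
    using (_^_; ^-congˡ; ^-congʳ; ^-homo-*; ^-assocʳ; ^-distrib-*)
  open SetoidReasoning setoid

  infix 4 _≟_
  _≟_ : Decidable _≈_
  x ≟ y with enum-sur x | enum-sur y
  ... | i , i↦x | j , j↦y with i Fin.≟ j
  ... | yes ≡.refl = yes (trans (sym i↦x) j↦y)
  ... | no i≢j = no λ x≈y → i≢j (enum-inj i j (trans i↦x (trans x≈y (sym j↦y))))

  *-cancelˡ : ∀ {x y z} → x ≉ 0# → x * y ≈ x * z → y ≈ z
  *-cancelˡ {x} {y} {z} x≉0 xy≈xz with inverse x x≉0
  ... | x⁻¹ , xx⁻¹≈1 = begin
    y                ≈⟨ *-identityˡ y ⟨
    1# * y           ≈⟨ *-congʳ (trans (*-comm x⁻¹ x) xx⁻¹≈1) ⟨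
    (x⁻¹ * x) * y    ≈⟨ *-assoc x⁻¹ x y ⟩
    x⁻¹ * (x * y)    ≈⟨ *-congˡ xy≈xz ⟩
    x⁻¹ * (x * z)    ≈⟨ *-assoc x⁻¹ x z ⟨
    (x⁻¹ * x) * z    ≈⟨ *-congʳ (trans (*-comm x⁻¹ x) xx⁻¹≈1) ⟩
    1# * z           ≈⟨ *-identityˡ z ⟩
    z                ∎

  x*y≈0⇒y≈0 : ∀ {x y} → x ≉ 0# → x * y ≈ 0# → y ≈ 0#
  x*y≈0⇒y≈0 {x} x≉0 xy≈0 = *-cancelˡ x≉0 (trans xy≈0 (sym (zeroʳ x)))

  x≉0∧y≉0⇒x*y≉0 : ∀ {x y} → x ≉ 0# → y ≉ 0# → x * y ≉ 0#
  x≉0∧y≉0⇒x*y≉0 x≉0 y≉0 xy≈0 = y≉0 (x*y≈0⇒y≈0 x≉0 xy≈0)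

  x≉0⇒x^n≉0 : ∀ {x} n → x ≉ 0# → x ^ n ≉ 0#
  x≉0⇒x^n≉0 zero    x≉0 = 1≉0
  x≉0⇒x^n≉0 (suc n) x≉0 = x≉0∧y≉0⇒x*y≉0 x≉0 (x≉0⇒x^n≉0 n x≉0)

  x^n≈0⇒x≈0 : ∀ {x} n → x ^ n ≈ 0# → x ≈ 0#
  x^n≈0⇒x≈0 {x} n xⁿ≈0 with x ≟ 0#
  ... | yes x≈0 = x≈0
  ... | no  x≉0 = ⊥-elim (x≉0⇒x^n≉0 n x≉0 xⁿ≈0)

  0^n≈0 : ∀ {n} → 1 ≤ n → 0# ^ n ≈ 0#
  0^n≈0 (s≤s _) = zeroˡ _

  x≈0⇒x^[1+n]≈x : ∀ {x} n → x ≈ 0# → x ^ suc n ≈ x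
  x≈0⇒x^[1+n]≈x n x≈0 = trans (*-congʳ x≈0) (trans (zeroˡ _) (sym x≈0))

  1^n≈1 : ∀ n → 1# ^ n ≈ 1#
  1^n≈1 zero    = refl
  1^n≈1 (suc n) = trans (*-identityˡ _) (1^n≈1 n)

  -1≉0 : - 1# ≉ 0#
  -1≉0 -1≈0 = 1≉0 (trans (sym (-‿involutive 1#)) (trans (-‿cong -1≈0) -0#≈0#))

module Polynomials {c ℓ q} (F : FiniteField c ℓ q) where
  open FiniteField F
  open FieldProperties F
  open SetoidReasoning setoid

  Pol : Set c
  Pol = Poly F

  infixl 6 _+ₚ_
  infixl 7 _*ₚ_
  infixr 8 _^ₚ_

  coeff : Pol → ℕ → Carrier
  coeff = Defs.coeff F
  _+ₚ_ _*ₚ_ : Pol → Pol → Pol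
  _+ₚ_ = Defs._+ₚ_ F
  _*ₚ_ = Defs._*ₚ_ F
  _^ₚ_ : Pol → ℕ → Pol
  _^ₚ_ = Defs._^ₚ_ F
  negₚ : Pol → Pol
  negₚ = Defs.negₚ F
  scale : Carrier → Pol → Pol
  scale = Defs.scale F
  eval : Pol → Carrier → Carrier
  eval = Defs.eval F
  Xₚ : Pol
  Xₚ = Defs.Xₚ F

  constₚ : Carrier → Pol
  constₚ = Defs.constₚ F

  1ₚ : Pol
  1ₚ = constₚ 1#

  X+_ : Carrier → Pol
  X+ a = Xₚ +ₚ constₚ a

  shift : Pol → Pol
  shift P = 0# ∷ P

  -- A record rather than Defs._≋_, so that both sides can be inferred from an equation.
  infix 4 _≈ₚ_
  record _≈ₚ_ (P Q : Pol) : Set ℓ where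
    constructor coeffwise
    field coeff-≈ : ∀ i → coeff P i ≈ coeff Q i
  open _≈ₚ_ public

  ≈ₚ-refl : ∀ {P} → P ≈ₚ P
  ≈ₚ-refl = coeffwise λ _ → refl

  ≈ₚ-sym : ∀ {P Q} → P ≈ₚ Q → Q ≈ₚ P
  ≈ₚ-sym P≈Q = coeffwise λ i → sym (coeff-≈ P≈Q i)

  ≈ₚ-trans : ∀ {P Q R} → P ≈ₚ Q → Q ≈ₚ R → P ≈ₚ R
  ≈ₚ-trans P≈Q Q≈R = coeffwise λ i → trans (coeff-≈ P≈Q i) (coeff-≈ Q≈R i)

  ≈ₚ-setoid : Setoid c ℓ
  ≈ₚ-setoid = record
    { Carrier = Pol ; _≈_ = _≈ₚ_
    ; isEquivalence = record { refl = ≈ₚ-refl ; sym = ≈ₚ-sym ; trans = ≈ₚ-trans } }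

  coeff-+ₚ : ∀ P Q i → coeff (P +ₚ Q) i ≈ coeff P i + coeff Q i
  coeff-+ₚ []      Q       i       = sym (+-identityˡ _)
  coeff-+ₚ (a ∷ P) []      i       = sym (+-identityʳ _)
  coeff-+ₚ (a ∷ P) (b ∷ Q) zero    = refl
  coeff-+ₚ (a ∷ P) (b ∷ Q) (suc i) = coeff-+ₚ P Q i

  coeff-negₚ : ∀ P i → coeff (negₚ P) i ≈ - coeff P i
  coeff-negₚ []      i       = sym -0#≈0#
  coeff-negₚ (a ∷ P) zero    = refl
  coeff-negₚ (a ∷ P) (suc i) = coeff-negₚ P i

  coeff-scale : ∀ a P i → coeff (scale a P) i ≈ a * coeff P i
  coeff-scale a []      i       = sym (zeroʳ a)
  coeff-scale a (b ∷ P) zero    = refl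
  coeff-scale a (b ∷ P) (suc i) = coeff-scale a P i

  +ₚ-cong : ∀ {P P′ Q Q′} → P ≈ₚ P′ → Q ≈ₚ Q′ → P +ₚ Q ≈ₚ P′ +ₚ Q′
  +ₚ-cong {P} {P′} {Q} {Q′} P≈P′ Q≈Q′ = coeffwise λ i → begin
    coeff (P +ₚ Q) i        ≈⟨ coeff-+ₚ P Q i ⟩
    coeff P i + coeff Q i   ≈⟨ +-cong (coeff-≈ P≈P′ i) (coeff-≈ Q≈Q′ i) ⟩
    coeff P′ i + coeff Q′ i ≈⟨ coeff-+ₚ P′ Q′ i ⟨
    coeff (P′ +ₚ Q′) i      ∎

  negₚ-cong : ∀ {P Q} → P ≈ₚ Q → negₚ P ≈ₚ negₚ Q
  negₚ-cong {P} {Q} P≈Q = coeffwise λ i →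
    trans (coeff-negₚ P i) (trans (-‿cong (coeff-≈ P≈Q i)) (sym (coeff-negₚ Q i)))

  +ₚ-abelianGroup : AbelianGroup c ℓ
  +ₚ-abelianGroup = record
    { Carrier = Pol ; _≈_ = _≈ₚ_ ; _∙_ = _+ₚ_ ; ε = [] ; _⁻¹ = negₚ
    ; isAbelianGroup = record
      { isGroup = record
        { isMonoid = record
          { isSemigroup = record
            { isMagma = record { isEquivalence = Setoid.isEquivalence ≈ₚ-setoid ; ∙-cong = +ₚ-cong }
            ; assoc = assoc }
          ; identity = (λ _ → ≈ₚ-refl) , identityʳ }
        ; inverse = inverseˡ , inverseʳ
        ; ⁻¹-cong = negₚ-cong }
      ; comm = comm } }
    where
    assoc : ∀ P Q R → (P +ₚ Q) +ₚ R ≈ₚ P +ₚ (Q +ₚ R)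
    assoc P Q R = coeffwise λ i → begin
      coeff ((P +ₚ Q) +ₚ R) i              ≈⟨ trans (coeff-+ₚ (P +ₚ Q) R i) (+-congʳ (coeff-+ₚ P Q i)) ⟩
      (coeff P i + coeff Q i) + coeff R i  ≈⟨ +-assoc _ _ _ ⟩
      coeff P i + (coeff Q i + coeff R i)  ≈⟨ trans (coeff-+ₚ P (Q +ₚ R) i) (+-congˡ (coeff-+ₚ Q R i)) ⟨
      coeff (P +ₚ (Q +ₚ R)) i              ∎
    identityʳ : ∀ P → P +ₚ [] ≈ₚ P
    identityʳ P = coeffwise λ i → trans (coeff-+ₚ P [] i) (+-identityʳ _)
    inverseˡ : ∀ P → negₚ P +ₚ P ≈ₚ []
    inverseˡ P = coeffwise λ i →
      trans (coeff-+ₚ (negₚ P) P i) (trans (+-congʳ (coeff-negₚ P i)) (-‿inverseˡ _))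
    inverseʳ : ∀ P → P +ₚ negₚ P ≈ₚ []
    inverseʳ P = coeffwise λ i →
      trans (coeff-+ₚ P (negₚ P) i) (trans (+-congˡ (coeff-negₚ P i)) (-‿inverseʳ _))
    comm : ∀ P Q → P +ₚ Q ≈ₚ Q +ₚ P
    comm P Q = coeffwise λ i → trans (coeff-+ₚ P Q i) (trans (+-comm _ _) (sym (coeff-+ₚ Q P i)))

  open AbelianGroup +ₚ-abelianGroup public using ()
    renaming (identityʳ to +ₚ-identityʳ; inverseʳ to +ₚ-inverseʳ; commutativeMonoid to +ₚ-commutativeMonoid)
  open import Algebra.Properties.AbelianGroup +ₚ-abelianGroup public using ()
    renaming (⁻¹-∙-comm to negₚ-+ₚ-comm; x∙y⁻¹≈ε⇒x≈y to P-Q≈0⇒P≈Q)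
  open import Algebra.Properties.CommutativeSemigroup
    (AbelianGroup.commutativeSemigroup +ₚ-abelianGroup) public using ()
    renaming (interchange to +ₚ-interchange)

  scale-cong : ∀ {a b P Q} → a ≈ b → P ≈ₚ Q → scale a P ≈ₚ scale b Q
  scale-cong {a} {b} {P} {Q} a≈b P≈Q = coeffwise λ i →
    trans (coeff-scale a P i) (trans (*-cong a≈b (coeff-≈ P≈Q i)) (sym (coeff-scale b Q i)))

  scale-distrib-+ₚ : ∀ a P Q → scale a (P +ₚ Q) ≈ₚ scale a P +ₚ scale a Q
  scale-distrib-+ₚ a P Q = coeffwise λ i → begin
    coeff (scale a (P +ₚ Q)) i       ≈⟨ trans (coeff-scale a (P +ₚ Q) i) (*-congˡ (coeff-+ₚ P Q i)) ⟩
    a * (coeff P i + coeff Q i)      ≈⟨ distribˡ _ _ _ ⟩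
    a * coeff P i + a * coeff Q i    ≈⟨ trans (coeff-+ₚ (scale a P) (scale a Q) i)
                                              (+-cong (coeff-scale a P i) (coeff-scale a Q i)) ⟨
    coeff (scale a P +ₚ scale a Q) i ∎

  scale-distrib-+ : ∀ a b P → scale (a + b) P ≈ₚ scale a P +ₚ scale b P
  scale-distrib-+ a b P = coeffwise λ i → begin
    coeff (scale (a + b) P) i        ≈⟨ coeff-scale (a + b) P i ⟩
    (a + b) * coeff P i              ≈⟨ distribʳ _ _ _ ⟩
    a * coeff P i + b * coeff P i    ≈⟨ trans (coeff-+ₚ (scale a P) (scale b P) i)
                                              (+-cong (coeff-scale a P i) (coeff-scale b P i)) ⟨
    coeff (scale a P +ₚ scale b P) i ∎

  scale-assoc : ∀ a b P → scale a (scale b P) ≈ₚ scale (a * b) P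
  scale-assoc a b P = coeffwise λ i → begin
    coeff (scale a (scale b P)) i ≈⟨ trans (coeff-scale a (scale b P) i) (*-congˡ (coeff-scale b P i)) ⟩
    a * (b * coeff P i)           ≈⟨ *-assoc _ _ _ ⟨
    (a * b) * coeff P i           ≈⟨ coeff-scale (a * b) P i ⟨
    coeff (scale (a * b) P) i     ∎

  scale-identity : ∀ P → scale 1# P ≈ₚ P
  scale-identity P = coeffwise λ i → trans (coeff-scale 1# P i) (*-identityˡ _)

  scale-zero : ∀ P → scale 0# P ≈ₚ []
  scale-zero P = coeffwise λ i → trans (coeff-scale 0# P i) (zeroˡ _)

  negₚ≈scale-1 : ∀ P → negₚ P ≈ₚ scale (- 1#) P
  negₚ≈scale-1 P = coeffwise λ i →
    trans (coeff-negₚ P i) (sym (trans (coeff-scale (- 1#) P i) (-1*x≈-x _)))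

  shift-cong : ∀ {P Q} → P ≈ₚ Q → shift P ≈ₚ shift Q
  shift-cong P≈Q = coeffwise λ { zero → refl ; (suc i) → coeff-≈ P≈Q i }

  shift-+ₚ : ∀ P Q → shift (P +ₚ Q) ≈ₚ shift P +ₚ shift Q
  shift-+ₚ P Q = coeffwise λ { zero → sym (+-identityˡ 0#) ; (suc i) → refl }

  scale-shift : ∀ a P → scale a (shift P) ≈ₚ shift (scale a P)
  scale-shift a P = coeffwise λ { zero → zeroʳ a ; (suc i) → refl }

  ∷-injectiveʳ : ∀ {a b P Q} → a ∷ P ≈ₚ b ∷ Q → P ≈ₚ Q
  ∷-injectiveʳ a∷P≈b∷Q = coeffwise λ i → coeff-≈ a∷P≈b∷Q (suc i)

  ∷≈0⇒≈0 : ∀ {a P} → a ∷ P ≈ₚ [] → P ≈ₚ []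
  ∷≈0⇒≈0 a∷P≈0 = coeffwise λ i → coeff-≈ a∷P≈0 (suc i)

module PolynomialProducts {c ℓ q} (F : FiniteField c ℓ q) where
  open FiniteField F
  open FieldProperties F
  open Polynomials F
  open SetoidReasoning ≈ₚ-setoid

  *ₚ-zeroˡ : ∀ P Q → P ≈ₚ [] → P *ₚ Q ≈ₚ []
  *ₚ-zeroˡ []      Q P≈0 = ≈ₚ-refl
  *ₚ-zeroˡ (a ∷ P) Q P≈0 = begin
    scale a Q +ₚ shift (P *ₚ Q) ≈⟨ +ₚ-cong (scale-cong (coeff-≈ P≈0 0) ≈ₚ-refl)
                                            (shift-cong (*ₚ-zeroˡ P Q (∷≈0⇒≈0 P≈0))) ⟩
    scale 0# Q +ₚ shift []      ≈⟨ +ₚ-cong (scale-zero Q) (coeffwise λ { zero → refl ; (suc i) → refl }) ⟩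
    []                          ∎

  *ₚ-zeroʳ : ∀ P Q → Q ≈ₚ [] → P *ₚ Q ≈ₚ []
  *ₚ-zeroʳ []      Q Q≈0 = ≈ₚ-refl
  *ₚ-zeroʳ (a ∷ P) Q Q≈0 = begin
    scale a Q +ₚ shift (P *ₚ Q) ≈⟨ +ₚ-cong (scale-cong refl Q≈0) (shift-cong (*ₚ-zeroʳ P Q Q≈0)) ⟩
    [] +ₚ shift []              ≈⟨ coeffwise (λ { zero → refl ; (suc i) → refl }) ⟩
    []                          ∎

  *ₚ-congˡ : ∀ {P P′} Q → P ≈ₚ P′ → P *ₚ Q ≈ₚ P′ *ₚ Q
  *ₚ-congˡ {[]}    {[]}     Q P≈P′ = ≈ₚ-refl
  *ₚ-congˡ {[]}    {b ∷ P′} Q P≈P′ = ≈ₚ-sym (*ₚ-zeroˡ (b ∷ P′) Q (≈ₚ-sym P≈P′))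
  *ₚ-congˡ {a ∷ P} {[]}     Q P≈P′ = *ₚ-zeroˡ (a ∷ P) Q P≈P′
  *ₚ-congˡ {a ∷ P} {b ∷ P′} Q P≈P′ =
    +ₚ-cong (scale-cong (coeff-≈ P≈P′ 0) ≈ₚ-refl) (shift-cong (*ₚ-congˡ Q (∷-injectiveʳ P≈P′)))

  *ₚ-congʳ : ∀ P {Q Q′} → Q ≈ₚ Q′ → P *ₚ Q ≈ₚ P *ₚ Q′
  *ₚ-congʳ []      Q≈Q′ = ≈ₚ-refl
  *ₚ-congʳ (a ∷ P) Q≈Q′ = +ₚ-cong (scale-cong refl Q≈Q′) (shift-cong (*ₚ-congʳ P Q≈Q′))

  *ₚ-distribʳ : ∀ P P′ Q → (P +ₚ P′) *ₚ Q ≈ₚ P *ₚ Q +ₚ P′ *ₚ Q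
  *ₚ-distribʳ []      P′       Q = ≈ₚ-refl
  *ₚ-distribʳ (a ∷ P) []       Q = ≈ₚ-sym (+ₚ-identityʳ _)
  *ₚ-distribʳ (a ∷ P) (b ∷ P′) Q = begin
    scale (a + b) Q +ₚ shift ((P +ₚ P′) *ₚ Q)
      ≈⟨ +ₚ-cong (scale-distrib-+ a b Q)
                 (≈ₚ-trans (shift-cong (*ₚ-distribʳ P P′ Q)) (shift-+ₚ (P *ₚ Q) (P′ *ₚ Q))) ⟩
    (scale a Q +ₚ scale b Q) +ₚ (shift (P *ₚ Q) +ₚ shift (P′ *ₚ Q))
      ≈⟨ +ₚ-interchange (scale a Q) (scale b Q) (shift (P *ₚ Q)) (shift (P′ *ₚ Q)) ⟩
    (scale a Q +ₚ shift (P *ₚ Q)) +ₚ (scale b Q +ₚ shift (P′ *ₚ Q)) ∎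

  *ₚ-distribˡ : ∀ P Q Q′ → P *ₚ (Q +ₚ Q′) ≈ₚ P *ₚ Q +ₚ P *ₚ Q′
  *ₚ-distribˡ []      Q Q′ = ≈ₚ-refl
  *ₚ-distribˡ (a ∷ P) Q Q′ = begin
    scale a (Q +ₚ Q′) +ₚ shift (P *ₚ (Q +ₚ Q′))
      ≈⟨ +ₚ-cong (scale-distrib-+ₚ a Q Q′)
                 (≈ₚ-trans (shift-cong (*ₚ-distribˡ P Q Q′)) (shift-+ₚ (P *ₚ Q) (P *ₚ Q′))) ⟩
    (scale a Q +ₚ scale a Q′) +ₚ (shift (P *ₚ Q) +ₚ shift (P *ₚ Q′))
      ≈⟨ +ₚ-interchange (scale a Q) (scale a Q′) (shift (P *ₚ Q)) (shift (P *ₚ Q′)) ⟩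
    (scale a Q +ₚ shift (P *ₚ Q)) +ₚ (scale a Q′ +ₚ shift (P *ₚ Q′)) ∎

  *ₚ-scaleˡ : ∀ a P Q → scale a P *ₚ Q ≈ₚ scale a (P *ₚ Q)
  *ₚ-scaleˡ a []      Q = ≈ₚ-refl
  *ₚ-scaleˡ a (b ∷ P) Q = begin
    scale (a * b) Q +ₚ shift (scale a P *ₚ Q)
      ≈⟨ +ₚ-cong (≈ₚ-sym (scale-assoc a b Q))
                 (≈ₚ-trans (shift-cong (*ₚ-scaleˡ a P Q)) (≈ₚ-sym (scale-shift a (P *ₚ Q)))) ⟩
    scale a (scale b Q) +ₚ scale a (shift (P *ₚ Q))
      ≈⟨ scale-distrib-+ₚ a (scale b Q) (shift (P *ₚ Q)) ⟨
    scale a (scale b Q +ₚ shift (P *ₚ Q)) ∎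

  *ₚ-scaleʳ : ∀ a P Q → P *ₚ scale a Q ≈ₚ scale a (P *ₚ Q)
  *ₚ-scaleʳ a []      Q = ≈ₚ-refl
  *ₚ-scaleʳ a (b ∷ P) Q = begin
    scale b (scale a Q) +ₚ shift (P *ₚ scale a Q)
      ≈⟨ +ₚ-cong (≈ₚ-trans (scale-assoc b a Q) (≈ₚ-trans (scale-cong (*-comm b a) ≈ₚ-refl)
                                                          (≈ₚ-sym (scale-assoc a b Q))))
                 (≈ₚ-trans (shift-cong (*ₚ-scaleʳ a P Q)) (≈ₚ-sym (scale-shift a (P *ₚ Q)))) ⟩
    scale a (scale b Q) +ₚ scale a (shift (P *ₚ Q))
      ≈⟨ scale-distrib-+ₚ a (scale b Q) (shift (P *ₚ Q)) ⟨
    scale a (scale b Q +ₚ shift (P *ₚ Q)) ∎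

  *ₚ-shiftˡ : ∀ P Q → shift P *ₚ Q ≈ₚ shift (P *ₚ Q)
  *ₚ-shiftˡ P Q = +ₚ-cong (scale-zero Q) ≈ₚ-refl

  *ₚ-assoc : ∀ P Q R → (P *ₚ Q) *ₚ R ≈ₚ P *ₚ (Q *ₚ R)
  *ₚ-assoc []      Q R = ≈ₚ-refl
  *ₚ-assoc (a ∷ P) Q R = begin
    (scale a Q +ₚ shift (P *ₚ Q)) *ₚ R    ≈⟨ *ₚ-distribʳ (scale a Q) (shift (P *ₚ Q)) R ⟩
    scale a Q *ₚ R +ₚ shift (P *ₚ Q) *ₚ R ≈⟨ +ₚ-cong (*ₚ-scaleˡ a Q R)
                                                     (≈ₚ-trans (*ₚ-shiftˡ (P *ₚ Q) R) (shift-cong (*ₚ-assoc P Q R))) ⟩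
    scale a (Q *ₚ R) +ₚ shift (P *ₚ (Q *ₚ R)) ∎

  *ₚ-identityˡ : ∀ Q → 1ₚ *ₚ Q ≈ₚ Q
  *ₚ-identityˡ Q = ≈ₚ-trans (+ₚ-cong (scale-identity Q) (coeffwise λ { zero → refl ; (suc i) → refl }))
                             (+ₚ-identityʳ Q)

  Xₚ*ₚP≈shiftP : ∀ P → Xₚ *ₚ P ≈ₚ shift P
  Xₚ*ₚP≈shiftP P = ≈ₚ-trans (*ₚ-shiftˡ 1ₚ P) (shift-cong (*ₚ-identityˡ P))

  *ₚ-negₚˡ : ∀ P Q → negₚ P *ₚ Q ≈ₚ negₚ (P *ₚ Q)
  *ₚ-negₚˡ P Q = ≈ₚ-trans (*ₚ-congˡ Q (negₚ≈scale-1 P))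
                 (≈ₚ-trans (*ₚ-scaleˡ (- 1#) P Q) (≈ₚ-sym (negₚ≈scale-1 (P *ₚ Q))))

  *ₚ-negₚʳ : ∀ P Q → P *ₚ negₚ Q ≈ₚ negₚ (P *ₚ Q)
  *ₚ-negₚʳ P Q = ≈ₚ-trans (*ₚ-congʳ P (negₚ≈scale-1 Q))
                 (≈ₚ-trans (*ₚ-scaleʳ (- 1#) P Q) (≈ₚ-sym (negₚ≈scale-1 (P *ₚ Q))))

  ^ₚ-homo-*ₚ : ∀ P m n → P ^ₚ (m ℕ.+ n) ≈ₚ P ^ₚ m *ₚ P ^ₚ n
  ^ₚ-homo-*ₚ P zero    n = ≈ₚ-sym (*ₚ-identityˡ (P ^ₚ n))
  ^ₚ-homo-*ₚ P (suc m) n =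
    ≈ₚ-trans (*ₚ-congʳ P (^ₚ-homo-*ₚ P m n)) (≈ₚ-sym (*ₚ-assoc P (P ^ₚ m) (P ^ₚ n)))

  shift^ : ℕ → Pol → Pol
  shift^ zero    P = P
  shift^ (suc n) P = shift (shift^ n P)

  Xₚ^ₚn*ₚP≈shift^nP : ∀ n P → Xₚ ^ₚ n *ₚ P ≈ₚ shift^ n P
  Xₚ^ₚn*ₚP≈shift^nP zero    P = *ₚ-identityˡ P
  Xₚ^ₚn*ₚP≈shift^nP (suc n) P = begin
    (Xₚ *ₚ Xₚ ^ₚ n) *ₚ P    ≈⟨ *ₚ-congˡ P (Xₚ*ₚP≈shiftP (Xₚ ^ₚ n)) ⟩
    shift (Xₚ ^ₚ n) *ₚ P    ≈⟨ *ₚ-shiftˡ (Xₚ ^ₚ n) P ⟩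
    shift (Xₚ ^ₚ n *ₚ P)    ≈⟨ shift-cong (Xₚ^ₚn*ₚP≈shift^nP n P) ⟩
    shift (shift^ n P)      ∎

  coeff-shift^-+ : ∀ n P j → coeff (shift^ n P) (n ℕ.+ j) ≡ coeff P j
  coeff-shift^-+ zero    P j = ≡.refl
  coeff-shift^-+ (suc n) P j = coeff-shift^-+ n P j

  coeff-shift^-< : ∀ n P i → i < n → coeff (shift^ n P) i ≡ 0#
  coeff-shift^-< (suc n) P zero    i<n       = ≡.refl
  coeff-shift^-< (suc n) P (suc i) (s≤s i<n) = coeff-shift^-< n P i i<n

  Xₚ^ₚn≈shift^n1ₚ : ∀ n → Xₚ ^ₚ n ≈ₚ shift^ n 1ₚ
  Xₚ^ₚn≈shift^n1ₚ zero    = ≈ₚ-refl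
  Xₚ^ₚn≈shift^n1ₚ (suc n) = ≈ₚ-trans (Xₚ*ₚP≈shiftP (Xₚ ^ₚ n)) (shift-cong (Xₚ^ₚn≈shift^n1ₚ n))

  coeff-Xⁿ-n : ∀ n → coeff (Xₚ ^ₚ n) n ≈ 1#
  coeff-Xⁿ-n n = trans (coeff-≈ (Xₚ^ₚn≈shift^n1ₚ n) n)
    (≡.subst (λ i → coeff (shift^ n 1ₚ) i ≈ 1#) (ℕ.+-identityʳ n) (reflexive (coeff-shift^-+ n 1ₚ 0)))

  coeff-Xⁿ->n : ∀ n i → n < i → coeff (Xₚ ^ₚ n) i ≈ 0#
  coeff-Xⁿ->n n i n<i with ℕ.m≤n⇒∃[o]m+o≡n n<i
  ... | k , n+1+k≡i = trans (coeff-≈ (Xₚ^ₚn≈shift^n1ₚ n) i)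
    (≡.subst (λ i → coeff (shift^ n 1ₚ) i ≈ 0#) (≡.trans (ℕ.+-suc n k) n+1+k≡i)
      (reflexive (coeff-shift^-+ n 1ₚ (suc k))))

  coeff-[X+a]*P : ∀ a P i → coeff ((X+ a) *ₚ P) (suc i) ≈ (0# + a) * coeff P (suc i) + coeff P i
  coeff-[X+a]*P a P i = trans (coeff-+ₚ (scale (0# + a) P) (shift (1ₚ *ₚ P)) (suc i))
    (+-cong (coeff-scale (0# + a) P (suc i)) (coeff-≈ (*ₚ-identityˡ P) i))

  coeff-[X+a]ⁿ->n : ∀ a n i → n < i → coeff ((X+ a) ^ₚ n) i ≈ 0#
  coeff-[X+a]ⁿ->n a zero    (suc i) _         = refl
  coeff-[X+a]ⁿ->n a (suc n) (suc i) (s≤s n<i) = trans (coeff-[X+a]*P a ((X+ a) ^ₚ n) i)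
    (trans (+-cong (trans (*-congˡ (coeff-[X+a]ⁿ->n a n (suc i) (ℕ.m<n⇒m<1+n n<i))) (zeroʳ _))
                   (coeff-[X+a]ⁿ->n a n i n<i))
           (+-identityˡ 0#))

  coeff-[X+a]ⁿ-n : ∀ a n → coeff ((X+ a) ^ₚ n) n ≈ 1#
  coeff-[X+a]ⁿ-n a zero    = refl
  coeff-[X+a]ⁿ-n a (suc n) = trans (coeff-[X+a]*P a ((X+ a) ^ₚ n) n)
    (trans (+-cong (trans (*-congˡ (coeff-[X+a]ⁿ->n a n (suc n) (ℕ.n<1+n n))) (zeroʳ _))
                   (coeff-[X+a]ⁿ-n a n))
           (+-identityˡ 1#))

  coeff-[X+a]ⁿ≈coeff-Xⁿ : ∀ a n i → n ≤ i → coeff ((X+ a) ^ₚ n) i ≈ coeff (Xₚ ^ₚ n) i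
  coeff-[X+a]ⁿ≈coeff-Xⁿ a n i n≤i with ℕ.m≤n⇒m<n∨m≡n n≤i
  ... | inj₁ n<i     = trans (coeff-[X+a]ⁿ->n a n i n<i) (sym (coeff-Xⁿ->n n i n<i))
  ... | inj₂ ≡.refl  = trans (coeff-[X+a]ⁿ-n a n) (sym (coeff-Xⁿ-n n))

module Evaluation {c ℓ q} (F : FiniteField c ℓ q) where
  open FiniteField F
  open FieldProperties F
  open Polynomials F
  open PolynomialProducts F
  open SetoidReasoning setoid
  open import Algebra.Solver.Ring.NaturalCoefficients.Default commutativeSemiring
    using (solve; _:=_; _:+_; _:*_)

  eval-≈0 : ∀ P x → P ≈ₚ [] → eval P x ≈ 0#
  eval-≈0 []      x P≈0 = refl
  eval-≈0 (a ∷ P) x P≈0 = begin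
    a + x * eval P x ≈⟨ +-cong (coeff-≈ P≈0 0) (*-congˡ (eval-≈0 P x (∷≈0⇒≈0 P≈0))) ⟩
    0# + x * 0#      ≈⟨ trans (+-identityˡ _) (zeroʳ x) ⟩
    0#               ∎

  eval-cong : ∀ {P Q} x → P ≈ₚ Q → eval P x ≈ eval Q x
  eval-cong {[]}    {[]}    x P≈Q = refl
  eval-cong {[]}    {b ∷ Q} x P≈Q = sym (eval-≈0 (b ∷ Q) x (≈ₚ-sym P≈Q))
  eval-cong {a ∷ P} {[]}    x P≈Q = eval-≈0 (a ∷ P) x P≈Q
  eval-cong {a ∷ P} {b ∷ Q} x P≈Q = +-cong (coeff-≈ P≈Q 0) (*-congˡ (eval-cong x (∷-injectiveʳ P≈Q)))

  eval-congʳ : ∀ P {x y} → x ≈ y → eval P x ≈ eval P y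
  eval-congʳ []      x≈y = refl
  eval-congʳ (a ∷ P) x≈y = +-congˡ (*-cong x≈y (eval-congʳ P x≈y))

  eval-+ₚ : ∀ P Q x → eval (P +ₚ Q) x ≈ eval P x + eval Q x
  eval-+ₚ []      Q       x = sym (+-identityˡ _)
  eval-+ₚ (a ∷ P) []      x = sym (+-identityʳ _)
  eval-+ₚ (a ∷ P) (b ∷ Q) x = begin
    (a + b) + x * eval (P +ₚ Q) x            ≈⟨ +-congˡ (*-congˡ (eval-+ₚ P Q x)) ⟩
    (a + b) + x * (eval P x + eval Q x)      ≈⟨ solve 5 (λ a b x u v → (a :+ b) :+ x :* (u :+ v)
                                                                   := (a :+ x :* u) :+ (b :+ x :* v))
                                                        refl a b x (eval P x) (eval Q x) ⟩
    (a + x * eval P x) + (b + x * eval Q x)  ∎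

  eval-scale : ∀ a P x → eval (scale a P) x ≈ a * eval P x
  eval-scale a []      x = sym (zeroʳ a)
  eval-scale a (b ∷ P) x = begin
    a * b + x * eval (scale a P) x ≈⟨ +-congˡ (*-congˡ (eval-scale a P x)) ⟩
    a * b + x * (a * eval P x)     ≈⟨ solve 4 (λ a b x u → a :* b :+ x :* (a :* u) := a :* (b :+ x :* u))
                                              refl a b x (eval P x) ⟩
    a * (b + x * eval P x)         ∎

  eval-negₚ : ∀ P x → eval (negₚ P) x ≈ - eval P x
  eval-negₚ P x = trans (eval-cong x (negₚ≈scale-1 P)) (trans (eval-scale (- 1#) P x) (-1*x≈-x _))

  eval-*ₚ : ∀ P Q x → eval (P *ₚ Q) x ≈ eval P x * eval Q x
  eval-*ₚ []      Q x = sym (zeroˡ _)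
  eval-*ₚ (a ∷ P) Q x = begin
    eval (scale a Q +ₚ shift (P *ₚ Q)) x        ≈⟨ eval-+ₚ (scale a Q) (shift (P *ₚ Q)) x ⟩
    eval (scale a Q) x + (0# + x * eval (P *ₚ Q) x)
      ≈⟨ +-cong (eval-scale a Q x) (trans (+-identityˡ _) (*-congˡ (eval-*ₚ P Q x))) ⟩
    a * eval Q x + x * (eval P x * eval Q x)    ≈⟨ solve 4 (λ a x u v → a :* v :+ x :* (u :* v)
                                                                      := (a :+ x :* u) :* v)
                                                           refl a x (eval P x) (eval Q x) ⟩
    (a + x * eval P x) * eval Q x               ∎

  eval-const : ∀ a x → eval (a ∷ []) x ≈ a
  eval-const a x = trans (+-congˡ (zeroʳ x)) (+-identityʳ a)

  eval-^ₚ : ∀ P n x → eval (P ^ₚ n) x ≈ eval P x ^ n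
  eval-^ₚ P zero    x = eval-const 1# x
  eval-^ₚ P (suc n) x = trans (eval-*ₚ P (P ^ₚ n) x) (*-congˡ (eval-^ₚ P n x))

  eval-Xₚ : ∀ x → eval Xₚ x ≈ x
  eval-Xₚ x = trans (+-identityˡ _) (trans (*-congˡ (eval-const 1# x)) (*-identityʳ x))

module Roots {c ℓ q} (F : FiniteField c ℓ q) where
  open FiniteField F
  open FieldProperties F
  open Polynomials F
  open Evaluation F
  open SetoidReasoning setoid
  open import Algebra.Solver.Ring.NaturalCoefficients.Default commutativeSemiring
    using (solve; _:=_; _:+_; _:*_)

  x-y+y≈x : ∀ x y → (x - y) + y ≈ x
  x-y+y≈x x y = trans (+-assoc _ _ _) (trans (+-congˡ (-‿inverseˡ y)) (+-identityʳ x))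

  quotientBy : Carrier → Pol → Pol
  quotientBy a []          = []
  quotientBy a (_ ∷ [])    = []
  quotientBy a (_ ∷ b ∷ R) = eval (b ∷ R) a ∷ quotientBy a (b ∷ R)

  eval-quotientBy : ∀ a P x → eval P x ≈ (x - a) * eval (quotientBy a P) x + eval P a
  eval-quotientBy a []          x = sym (trans (+-congʳ (zeroʳ _)) (+-identityˡ 0#))
  eval-quotientBy a (b ∷ [])    x = trans (eval-const b x)
    (sym (trans (+-cong (zeroʳ _) (eval-const b a)) (+-identityˡ b)))
  eval-quotientBy a (b ∷ d ∷ R) x = begin
    b + x * u                        ≈⟨ +-congˡ (*-cong x≈s+a (eval-quotientBy a (d ∷ R) x)) ⟩
    b + (s + a) * (s * Q + w)        ≈⟨ solve 5 (λ s a b Q w → b :+ (s :+ a) :* (s :* Q :+ w)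
                                                           := s :* (w :+ (s :+ a) :* Q) :+ (b :+ a :* w))
                                                 refl s a b Q w ⟩
    s * (w + (s + a) * Q) + (b + a * w)  ≈⟨ +-congʳ (*-congˡ (+-congˡ (*-congʳ (sym x≈s+a)))) ⟩
    s * (w + x * Q) + (b + a * w)    ∎
    where
    s = x - a
    u = eval (d ∷ R) x
    w = eval (d ∷ R) a
    Q = eval (quotientBy a (d ∷ R)) x
    x≈s+a : x ≈ s + a
    x≈s+a = sym (x-y+y≈x x a)

  length-quotientBy : ∀ a P → length (quotientBy a P) ≡ length P ∸ 1
  length-quotientBy a []          = ≡.refl
  length-quotientBy a (_ ∷ [])    = ≡.refl
  length-quotientBy a (_ ∷ b ∷ R) = ≡.cong suc (length-quotientBy a (b ∷ R))

  quotientBy≈0⇒≈0 : ∀ a P → quotientBy a P ≈ₚ [] → eval P a ≈ 0# → P ≈ₚ []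
  quotientBy≈0⇒≈0 a P Q≈0 Pa≈0 = coeffwise (go P Q≈0 Pa≈0)
    where
    go : ∀ P → quotientBy a P ≈ₚ [] → eval P a ≈ 0# → ∀ i → coeff P i ≈ 0#
    go []          Q≈0 Pa≈0 i       = refl
    go (b ∷ [])    Q≈0 Pa≈0 zero    = trans (sym (eval-const b a)) Pa≈0
    go (b ∷ [])    Q≈0 Pa≈0 (suc i) = refl
    go (b ∷ d ∷ R) Q≈0 Pa≈0 zero    =
      trans (sym (trans (+-congˡ (trans (*-congˡ (coeff-≈ Q≈0 0)) (zeroʳ a))) (+-identityʳ b))) Pa≈0
    go (b ∷ d ∷ R) Q≈0 Pa≈0 (suc i) = go (d ∷ R) (∷≈0⇒≈0 Q≈0) (coeff-≈ Q≈0 0) i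

  Distinct : List Carrier → Set (c ⊔ ℓ)
  Distinct = AllPairs _≉_

  vanishes-on-distinct⇒≈0 : ∀ rs → Distinct rs → ∀ P → All (λ r → eval P r ≈ 0#) rs
                           → length P ≤ length rs → P ≈ₚ []
  vanishes-on-distinct⇒≈0 []       _           []      _           _  = ≈ₚ-refl
  vanishes-on-distinct⇒≈0 (r ∷ rs) (r∉rs ∷ rs-distinct) P (Pr≈0 ∷ Prs≈0) ∣P∣≤ =
    quotientBy≈0⇒≈0 r P (vanishes-on-distinct⇒≈0 rs rs-distinct (quotientBy r P) Qrs≈0 ∣Q∣≤) Pr≈0
    where
    ∣Q∣≤ : length (quotientBy r P) ≤ length rs
    ∣Q∣≤ = ≡.subst (_≤ length rs) (≡.sym (length-quotientBy r P)) (ℕ.∸-monoˡ-≤ 1 ∣P∣≤)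
    Q-root : ∀ {s} → r ≉ s × eval P s ≈ 0# → eval (quotientBy r P) s ≈ 0#
    Q-root {s} (r≉s , Ps≈0) = x*y≈0⇒y≈0 s-r≉0 (+-identityˡ-unique _ _ (begin
      (s - r) * eval (quotientBy r P) s + eval P r ≈⟨ eval-quotientBy r P s ⟨
      eval P s                                    ≈⟨ trans Ps≈0 (sym Pr≈0) ⟩
      eval P r                                    ∎))
      where
      s-r≉0 : s - r ≉ 0#
      s-r≉0 s-r≈0 = r≉s (sym (trans (sym (x-y+y≈x s r)) (trans (+-congʳ s-r≈0) (+-identityˡ r))))
    Qrs≈0 : All (λ s → eval (quotientBy r P) s ≈ 0#) rs
    Qrs≈0 = All.map Q-root (All.zip (r∉rs , Prs≈0))

  Degree< : ℕ → Pol → Set ℓ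
  Degree< m P = ∀ i → m ≤ i → coeff P i ≈ 0#

  ≈ₚ-take : ∀ m P → Degree< m P → P ≈ₚ List.take m P
  ≈ₚ-take zero    P       P<m = coeffwise λ i → P<m i z≤n
  ≈ₚ-take (suc m) []      P<m = ≈ₚ-refl
  ≈ₚ-take (suc m) (a ∷ P) P<m = coeffwise λ
    { zero    → refl
    ; (suc i) → coeff-≈ (≈ₚ-take m P (λ i m≤i → P<m (suc i) (s≤s m≤i))) i }

  degree<q∧vanishing⇒≈0 : ∀ P → Degree< q P → (∀ x → eval P x ≈ 0#) → P ≈ₚ []
  degree<q∧vanishing⇒≈0 P P<q P≈0 = ≈ₚ-trans P≈P↾q
    (vanishes-on-distinct⇒≈0 elements elements-distinct (List.take q P)
      (All.universal (λ x → trans (eval-cong x (≈ₚ-sym P≈P↾q)) (P≈0 x)) elements) ∣P↾q∣≤q)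
    where
    elements : List Carrier
    elements = List.tabulate enum
    elements-distinct : Distinct elements
    elements-distinct = AllPairs.tabulate⁺ λ {i} {j} i≢j eᵢ≈eⱼ → i≢j (enum-inj i j eᵢ≈eⱼ)
    P≈P↾q : P ≈ₚ List.take q P
    P≈P↾q = ≈ₚ-take q P P<q
    ∣P↾q∣≤q : length (List.take q P) ≤ length elements
    ∣P↾q∣≤q rewrite List.length-take q P | List.length-tabulate enum = ℕ.m⊓n≤m q (length P)

module FiniteSums {c ℓ q₁} (F : FiniteField c ℓ (suc q₁)) where
  open FiniteField F
  open FieldProperties F
  open SetoidReasoning setoid

  q : ℕ
  q = suc q₁

  index : Carrier → Fin q
  index x = proj₁ (enum-sur x)

  enum-index : ∀ x → enum (index x) ≈ x
  enum-index x = proj₂ (enum-sur x)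

  index-≡⇒≈ : ∀ {x y} → index x ≡ index y → x ≈ y
  index-≡⇒≈ {x} {y} ix≡iy = trans (sym (enum-index x)) (trans (reflexive (≡.cong enum ix≡iy)) (enum-index y))

  module MonoidSums (M : CommutativeMonoid c ℓ) where
    private module M = CommutativeMonoid M
    open MonoidSum M using (sum; sum-cong-≋; sum-permute; sum-remove; sum-replicate)
    open import Algebra.Definitions.RawMonoid M.rawMonoid using () renaming (_×_ to _·_)

    Congruentᴹ : (Carrier → M.Carrier) → Set (c ⊔ ℓ)
    Congruentᴹ h = ∀ {x y} → x ≈ y → h x M.≈ h y

    ∑ : (Carrier → M.Carrier) → M.Carrier
    ∑ h = sum (h ∘ enum)

    ∑-bijection : (f g : Carrier → Carrier) → (∀ {x y} → x ≈ y → f x ≈ f y) → (∀ {x y} → x ≈ y → g x ≈ g y)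
                → (∀ y → f (g y) ≈ y) → (∀ x → g (f x) ≈ x)
                → ∀ h → Congruentᴹ h → ∑ (h ∘ f) M.≈ ∑ h
    ∑-bijection f g f-cong g-cong f∘g≈id g∘f≈id h h-cong = M.sym (M.trans
      (sum-permute (h ∘ enum) π)
      (sum-cong-≋ λ i → h-cong (enum-index (f (enum i)))))
      where
      π : Permutation.Permutation q q
      π = Permutation.permutation (index ∘ f ∘ enum) (index ∘ g ∘ enum)
        (λ i → enum-inj _ _ (trans (enum-index _) (trans (f-cong (enum-index _)) (f∘g≈id _))))
        (λ i → enum-inj _ _ (trans (enum-index _) (trans (g-cong (enum-index _)) (g∘f≈id _))))

    ∑-+-invariant : ∀ a h → Congruentᴹ h → ∑ (λ x → h (a + x)) M.≈ ∑ h
    ∑-+-invariant a h h-cong = ∑-bijection (a +_) (- a +_) +-congˡ +-congˡ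
      (λ y → trans (sym (+-assoc _ _ _)) (trans (+-congʳ (-‿inverseʳ a)) (+-identityˡ y)))
      (λ x → trans (sym (+-assoc _ _ _)) (trans (+-congʳ (-‿inverseˡ a)) (+-identityˡ x)))
      h h-cong

    ∑-*-invariant : ∀ {k} → k ≉ 0# → ∀ h → Congruentᴹ h → ∑ (λ x → h (k * x)) M.≈ ∑ h
    ∑-*-invariant {k} k≉0 h h-cong with inverse k k≉0
    ... | k⁻¹ , kk⁻¹≈1 = ∑-bijection (k *_) (k⁻¹ *_) *-congˡ *-congˡ
      (λ y → trans (sym (*-assoc _ _ _)) (trans (*-congʳ kk⁻¹≈1) (*-identityˡ y)))
      (λ x → trans (sym (*-assoc _ _ _)) (trans (*-congʳ (trans (*-comm k⁻¹ k) kk⁻¹≈1)) (*-identityˡ x)))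
      h h-cong

    ∑-constant-on-units : ∀ h k → Congruentᴹ h → h 0# M.≈ M.ε → (∀ x → x ≉ 0# → h x M.≈ k) → ∑ h M.≈ q₁ · k
    ∑-constant-on-units h k h-cong h0≈ε h≈k = M.trans (sum-remove {i = index 0#} (h ∘ enum)) (M.trans
      (M.∙-cong (M.trans (h-cong (enum-index 0#)) h0≈ε) (sum-cong-≋ λ j → h≈k _ (enum-punchIn≉0 j)))
      (M.trans (M.identityˡ _) (sum-replicate q₁)))
      where
      enum-punchIn≉0 : ∀ j → enum (Fin.punchIn (index 0#) j) ≉ 0#
      enum-punchIn≉0 j e≈0 = Fin.punchInᵢ≢i (index 0#) j (enum-inj _ _ (trans e≈0 (sym (enum-index 0#))))

  open MonoidSums +-commutativeMonoid public using (∑; ∑-bijection; ∑-+-invariant; ∑-*-invariant; ∑-constant-on-units)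
  private
    module Product = MonoidSums *-commutativeMonoid
  open MonoidSum +-commutativeMonoid using (sum-replicate; ∑-distrib-+; sum-cong-≋)
  open MonoidSum *-commutativeMonoid using () renaming (sum to product; ∑-distrib-+ to ∏-distrib-*)
  open import Algebra.Definitions.RawMonoid +-rawMonoid using () renaming (_×_ to _·_)

  ifZero : Carrier → (Carrier → Carrier) → Carrier → Carrier
  ifZero z f x with x ≟ 0#
  ... | yes _ = z
  ... | no  _ = f x

  ifZero-cong : ∀ z {f} → (∀ {x y} → x ≈ y → f x ≈ f y) → ∀ {x y} → x ≈ y → ifZero z f x ≈ ifZero z f y
  ifZero-cong z f-cong {x} {y} x≈y with x ≟ 0# | y ≟ 0#
  ... | yes _   | yes _   = refl
  ... | yes x≈0 | no  y≉0 = ⊥-elim (y≉0 (trans (sym x≈y) x≈0))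
  ... | no  x≉0 | yes y≈0 = ⊥-elim (x≉0 (trans x≈y y≈0))
  ... | no  _   | no  _   = f-cong x≈y

  ifZero-0 : ∀ z f {x} → x ≈ 0# → ifZero z f x ≈ z
  ifZero-0 z f {x} x≈0 with x ≟ 0#
  ... | yes _   = refl
  ... | no  x≉0 = ⊥-elim (x≉0 x≈0)

  ifZero-≉0 : ∀ z f {x} → x ≉ 0# → ifZero z f x ≈ f x
  ifZero-≉0 z f {x} x≉0 with x ≟ 0#
  ... | yes x≈0 = ⊥-elim (x≉0 x≈0)
  ... | no  _   = refl

  product≉0 : ∀ {n} (v : Fin n → Carrier) → (∀ i → v i ≉ 0#) → product v ≉ 0#
  product≉0 {zero}  v v≉0 = 1≉0
  product≉0 {suc n} v v≉0 = x≉0∧y≉0⇒x*y≉0 (v≉0 Fin.zero) (product≉0 (v ∘ Fin.suc) (v≉0 ∘ Fin.suc))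

  -- The products over F of k u and of u (with 0 replaced by 1) agree, and the former is k ^ q₁ times the
  -- latter; in the multiplicative monoid q₁ · k is k ^ q₁ by definition.
  x^q₁≈1 : ∀ {k} → k ≉ 0# → k ^ q₁ ≈ 1#
  x^q₁≈1 {k} k≉0 = *-cancelˡ N≉0 (begin
    N * k ^ q₁                         ≈⟨ *-comm N _ ⟩
    k ^ q₁ * N                         ≈⟨ *-congʳ (Product.∑-constant-on-units (ifZero 1# (λ _ → k)) k
                                                    (ifZero-cong 1# (λ _ → refl)) (ifZero-0 1# _ refl)
                                                    (λ x x≉0 → ifZero-≉0 1# _ x≉0)) ⟨
    Product.∑ (ifZero 1# (λ _ → k)) * N ≈⟨ ∏-distrib-* (ifZero 1# (λ _ → k) ∘ enum) (unit ∘ enum) ⟨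
    Product.∑ (λ x → ifZero 1# (λ _ → k) x * unit x) ≈⟨ MonoidSum.sum-cong-≋ *-commutativeMonoid
                                                          (λ i → sym (unit-*-homo (enum i))) ⟩
    Product.∑ (λ x → unit (k * x))     ≈⟨ Product.∑-*-invariant k≉0 unit unit-cong ⟩
    N                                  ≈⟨ *-identityʳ N ⟨
    N * 1#                             ∎)
    where
    unit : Carrier → Carrier
    unit = ifZero 1# (λ x → x)
    unit-cong : ∀ {x y} → x ≈ y → unit x ≈ unit y
    unit-cong = ifZero-cong 1# (λ x≈y → x≈y)
    N = Product.∑ unit
    N≉0 : N ≉ 0#
    N≉0 = product≉0 (unit ∘ enum) λ i → unit≉0 (enum i)
      where
      unit≉0 : ∀ x → unit x ≉ 0#
      unit≉0 x with x ≟ 0#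
      ... | yes _   = 1≉0
      ... | no  x≉0 = x≉0
    unit-*-homo : ∀ x → unit (k * x) ≈ ifZero 1# (λ _ → k) x * unit x
    unit-*-homo x with x ≟ 0# | (k * x) ≟ 0#
    ... | yes _   | yes _    = sym (*-identityˡ 1#)
    ... | yes x≈0 | no  kx≉0 = ⊥-elim (kx≉0 (trans (*-congˡ x≈0) (zeroʳ k)))
    ... | no  x≉0 | yes kx≈0 = ⊥-elim (x≉0∧y≉0⇒x*y≉0 k≉0 x≉0 kx≈0)
    ... | no  _   | no  _    = refl

  x^q≈x : ∀ x → x ^ q ≈ x
  x^q≈x x with x ≟ 0#
  ... | yes x≈0 = x≈0⇒x^[1+n]≈x q₁ x≈0
  ... | no  x≉0 = trans (*-congˡ (x^q₁≈1 x≉0)) (*-identityʳ x)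

  x^[t*q₁]≈1 : ∀ t {x} → x ≉ 0# → x ^ (t ℕ.* q₁) ≈ 1#
  x^[t*q₁]≈1 t {x} x≉0 = begin
    x ^ (t ℕ.* q₁)  ≡⟨ ≡.cong (x ^_) (ℕ.*-comm t q₁) ⟩
    x ^ (q₁ ℕ.* t)  ≈⟨ ^-assocʳ x q₁ t ⟨
    (x ^ q₁) ^ t    ≈⟨ ^-congˡ t (x^q₁≈1 x≉0) ⟩
    1# ^ t          ≈⟨ 1^n≈1 t ⟩
    1#              ∎

  -- Translation by 1 permutes F, so q · 1 = 0.
  ∑1≈0 : ∑ (λ _ → 1#) ≈ 0#
  ∑1≈0 = +-identityʳ-unique (∑ (λ x → x)) _ (begin
    ∑ (λ x → x) + ∑ (λ _ → 1#)   ≈⟨ ∑-distrib-+ enum (λ _ → 1#) ⟨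
    ∑ (λ x → x + 1#)             ≈⟨ sum-cong-≋ (λ i → +-comm (enum i) 1#) ⟩
    ∑ (λ x → 1# + x)             ≈⟨ ∑-+-invariant 1# (λ x → x) (λ x≈y → x≈y) ⟩
    ∑ (λ x → x)                  ∎)

  q₁·1≈-1 : q₁ · 1# ≈ - 1#
  q₁·1≈-1 = +-inverseʳ-unique 1# (q₁ · 1#) (trans (sym (sum-replicate q)) ∑1≈0)

module PowerSums {c ℓ q₂} (F : FiniteField c ℓ (2 ℕ.+ q₂)) where
  open FiniteField F
  open FieldProperties F
  open Polynomials F
  open PolynomialProducts F
  open Evaluation F
  open Roots F
  open FiniteSums F
  open import Algebra.Properties.Semiring.Sum semiring using (sum-cong-≋; *-distribˡ-sum)
  open SetoidReasoning setoid

  private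
    q₁ : ℕ
    q₁ = suc q₂

  σ : ℕ → Carrier
  σ j = ∑ (_^ j)

  σ[1+t*q₁]≈-1 : ∀ t → σ (suc t ℕ.* q₁) ≈ - 1#
  σ[1+t*q₁]≈-1 t = trans
    (∑-constant-on-units (_^ (suc t ℕ.* q₁)) 1# (^-congˡ (suc t ℕ.* q₁)) (0^n≈0 {suc t ℕ.* q₁} (s≤s z≤n))
                         (λ x → x^[t*q₁]≈1 (suc t)))
    q₁·1≈-1

  x^[1+j]≉x : ∀ j → 1 ≤ j → j < q₁ → ¬ (∀ x → x ^ suc j ≈ x)
  x^[1+j]≉x j@(suc k) _ j<q₁ x^[1+j]≈x = 1≉0 (begin
    1#                                          ≈⟨ trans (+-congˡ -0#≈0#) (+-identityʳ 1#) ⟨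
    1# + - 0#                                   ≈⟨ +-cong (coeff-Xⁿ-n (suc j)) (-‿cong refl) ⟨
    coeff (Xₚ ^ₚ suc j) (suc j) + - coeff Xₚ (suc j) ≈⟨ coeff-P (suc j) ⟨
    coeff P (suc j)                             ≈⟨ coeff-≈ P≈0 (suc j) ⟩
    0#                                          ∎)
    where
    P = Xₚ ^ₚ suc j +ₚ negₚ Xₚ
    coeff-P : ∀ i → coeff P i ≈ coeff (Xₚ ^ₚ suc j) i + - coeff Xₚ i
    coeff-P i = trans (coeff-+ₚ (Xₚ ^ₚ suc j) (negₚ Xₚ) i) (+-congˡ (coeff-negₚ Xₚ i))
    P<q : Degree< q P
    P<q (suc zero) (s≤s ())
    P<q i@(suc (suc _)) q≤i = trans (coeff-P i)
      (trans (+-cong (coeff-Xⁿ->n (suc j) i (ℕ.<-≤-trans (s≤s j<q₁) q≤i)) -0#≈0#) (+-identityʳ 0#))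
    P≈0 : P ≈ₚ []
    P≈0 = degree<q∧vanishing⇒≈0 P P<q λ x → begin
      eval P x                                ≈⟨ eval-+ₚ (Xₚ ^ₚ suc j) (negₚ Xₚ) x ⟩
      eval (Xₚ ^ₚ suc j) x + eval (negₚ Xₚ) x ≈⟨ +-cong (trans (eval-^ₚ Xₚ (suc j) x) (^-congˡ (suc j) (eval-Xₚ x)))
                                                         (trans (eval-negₚ Xₚ x) (-‿cong (eval-Xₚ x))) ⟩
      x ^ suc j + - x                         ≈⟨ +-congʳ (x^[1+j]≈x x) ⟩
      x + - x                                 ≈⟨ -‿inverseʳ x ⟩
      0#                                      ∎

  -- If σ j ≉ 0 then σ j = ∑ (k x) ^ j = k ^ j σ j makes k ^ j = 1 for every unit k, so X ^ (1 + j) - X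
  -- would vanish on F.
  σ-small : ∀ j → j < q₁ → σ j ≈ 0#
  σ-small zero        _    = ∑1≈0
  σ-small j@(suc _) j<q₁ with σ j ≟ 0#
  ... | yes σj≈0 = σj≈0
  ... | no  σj≉0 = ⊥-elim (x^[1+j]≉x j (s≤s z≤n) j<q₁ x^[1+j]≈x)
    where
    k^j≈1 : ∀ {k} → k ≉ 0# → k ^ j ≈ 1#
    k^j≈1 {k} k≉0 = *-cancelˡ σj≉0 (begin
      σ j * k ^ j                ≈⟨ *-comm _ _ ⟩
      k ^ j * σ j                ≈⟨ *-distribˡ-sum (k ^ j) (λ i → enum i ^ j) ⟩
      ∑ (λ x → k ^ j * x ^ j)    ≈⟨ sum-cong-≋ (λ i → ^-distrib-* k (enum i) j) ⟨
      ∑ (λ x → (k * x) ^ j)      ≈⟨ ∑-*-invariant k≉0 (_^ j) (^-congˡ j) ⟩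
      σ j                        ≈⟨ *-identityʳ _ ⟨
      σ j * 1#                   ∎)
    x^[1+j]≈x : ∀ x → x ^ suc j ≈ x
    x^[1+j]≈x x with x ≟ 0#
    ... | yes x≈0 = x≈0⇒x^[1+n]≈x j x≈0
    ... | no  x≉0 = trans (*-congˡ (k^j≈1 x≉0)) (*-identityʳ x)

  -- Bézout: x n ≡ ±1 modulo q₁ gives an inverse exponent to n on the units.
  coprime⇒nth-root : ∀ n → gcd n q₁ ≡ 1 → Σ ℕ λ e → ∀ {b} → b ≉ 0# → (b ^ n) ^ e ≈ b
  coprime⇒nth-root n gcd≡1 with coprime-Bézout (gcd≡1⇒coprime gcd≡1)
  ... | Bézout.+- x y 1+y*q₁≡x*n = x , λ {b} b≉0 → begin
    (b ^ n) ^ x             ≈⟨ ^-assocʳ b n x ⟩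
    b ^ (n ℕ.* x)           ≡⟨ ≡.cong (b ^_) (≡.trans (ℕ.*-comm n x) (≡.sym 1+y*q₁≡x*n)) ⟩
    b * b ^ (y ℕ.* q₁)      ≈⟨ *-congˡ (x^[t*q₁]≈1 y b≉0) ⟩
    b * 1#                  ≈⟨ *-identityʳ b ⟩
    b                       ∎
  ... | Bézout.-+ x y 1+x*n≡y*q₁ = q₂ ℕ.* x , root
    where
    root : ∀ {b} → b ≉ 0# → (b ^ n) ^ (q₂ ℕ.* x) ≈ b
    root {b} b≉0 = begin
      (b ^ n) ^ (q₂ ℕ.* x)    ≈⟨ ^-assocʳ b n (q₂ ℕ.* x) ⟩
      b ^ (n ℕ.* (q₂ ℕ.* x))  ≡⟨ ≡.cong (b ^_) n*[q₂*x]≡x*n*q₂ ⟩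
      b ^ (x ℕ.* n ℕ.* q₂)    ≈⟨ ^-assocʳ b (x ℕ.* n) q₂ ⟨
      b⁻¹ ^ q₂                ≈⟨ b⁻¹^q₂≈b ⟩
      b                       ∎
      where
      n*[q₂*x]≡x*n*q₂ : n ℕ.* (q₂ ℕ.* x) ≡ x ℕ.* n ℕ.* q₂
      n*[q₂*x]≡x*n*q₂ = ≡.trans (≡.cong (n ℕ.*_) (ℕ.*-comm q₂ x))
        (≡.trans (≡.sym (ℕ.*-assoc n x q₂)) (≡.cong (ℕ._* q₂) (ℕ.*-comm n x)))
      b⁻¹ = b ^ (x ℕ.* n)
      b*b⁻¹≈1 : b * b⁻¹ ≈ 1#
      b*b⁻¹≈1 = ≡.subst (λ e → b ^ e ≈ 1#) (≡.sym 1+x*n≡y*q₁) (x^[t*q₁]≈1 y b≉0)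
      b⁻¹^q₂≈b : b⁻¹ ^ q₂ ≈ b
      b⁻¹^q₂≈b = *-cancelˡ (x≉0⇒x^n≉0 q₂ b≉0) (begin
        b ^ q₂ * b⁻¹ ^ q₂     ≈⟨ ^-distrib-* b b⁻¹ q₂ ⟨
        (b * b⁻¹) ^ q₂        ≈⟨ trans (^-congˡ q₂ b*b⁻¹≈1) (1^n≈1 q₂) ⟩
        1#                    ≈⟨ x^q₁≈1 b≉0 ⟨
        b * b ^ q₂            ≈⟨ *-comm b _ ⟩
        b ^ q₂ * b            ∎)

  coprime⇒^-injective : ∀ n → 1 ≤ n → gcd n q₁ ≡ 1 → ∀ {x y} → x ^ n ≈ y ^ n → x ≈ y
  coprime⇒^-injective n 1≤n gcd≡1 {x} {y} xⁿ≈yⁿ with x ≟ 0# | y ≟ 0#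
  ... | yes x≈0 | yes y≈0 = trans x≈0 (sym y≈0)
  ... | yes x≈0 | no  y≉0 = ⊥-elim (y≉0 (x^n≈0⇒x≈0 n (trans (sym xⁿ≈yⁿ) (trans (^-congˡ n x≈0) (0^n≈0 1≤n)))))
  ... | no  x≉0 | yes y≈0 = ⊥-elim (x≉0 (x^n≈0⇒x≈0 n (trans xⁿ≈yⁿ (trans (^-congˡ n y≈0) (0^n≈0 1≤n)))))
  ... | no  x≉0 | no  y≉0 = trans (sym (root x≉0)) (trans (^-congˡ e xⁿ≈yⁿ) (root y≉0))
    where
    e = proj₁ (coprime⇒nth-root n gcd≡1)
    root = proj₂ (coprime⇒nth-root n gcd≡1)

  coprime⇒^-surjective : ∀ n → 1 ≤ n → gcd n q₁ ≡ 1 → ∀ b → Σ Carrier λ x → x ^ n ≈ b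
  coprime⇒^-surjective n 1≤n gcd≡1 b with b ≟ 0#
  ... | yes b≈0 = 0# , trans (0^n≈0 1≤n) (sym b≈0)
  ... | no  b≉0 = b ^ e , (begin
    (b ^ e) ^ n     ≈⟨ ^-assocʳ b e n ⟩
    b ^ (e ℕ.* n)   ≡⟨ ≡.cong (b ^_) (ℕ.*-comm e n) ⟩
    b ^ (n ℕ.* e)   ≈⟨ ^-assocʳ b n e ⟨
    (b ^ n) ^ e     ≈⟨ proj₂ (coprime⇒nth-root n gcd≡1) b≉0 ⟩
    b               ∎)
    where
    e = proj₁ (coprime⇒nth-root n gcd≡1)

module TranslateSums {c ℓ q₂} (F : FiniteField c ℓ (2 ℕ.+ q₂)) where
  open FiniteField F
  open FieldProperties F
  open Polynomials F
  open PolynomialProducts F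
  open Evaluation F
  open Roots F
  open FiniteSums F
  open PowerSums F
  open MonoidSum +-commutativeMonoid using (sum)
  open MonoidSum +ₚ-commutativeMonoid using ()
    renaming (sum to sumₚ; sum-cong-≋ to sumₚ-cong; ∑-distrib-+ to sumₚ-distrib-+ₚ)
  open SetoidReasoning setoid

  coeff-sumₚ : ∀ {n} (v : Fin n → Pol) i → coeff (sumₚ v) i ≈ sum (λ j → coeff (v j) i)
  coeff-sumₚ {zero}  v i = refl
  coeff-sumₚ {suc n} v i = trans (coeff-+ₚ (v Fin.zero) _ i) (+-congˡ (coeff-sumₚ (v ∘ Fin.suc) i))

  eval-sumₚ : ∀ {n} (v : Fin n → Pol) x → eval (sumₚ v) x ≈ sum (λ j → eval (v j) x)
  eval-sumₚ {zero}  v x = refl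
  eval-sumₚ {suc n} v x = trans (eval-+ₚ (v Fin.zero) _ x) (+-congˡ (eval-sumₚ (v ∘ Fin.suc) x))

  *ₚ-distribˡ-sumₚ : ∀ {n} K (v : Fin n → Pol) → K *ₚ sumₚ v ≈ₚ sumₚ (λ j → K *ₚ v j)
  *ₚ-distribˡ-sumₚ {zero}  K v = *ₚ-zeroʳ K [] ≈ₚ-refl
  *ₚ-distribˡ-sumₚ {suc n} K v = ≈ₚ-trans (*ₚ-distribˡ K (v Fin.zero) _)
    (+ₚ-cong ≈ₚ-refl (*ₚ-distribˡ-sumₚ K (v ∘ Fin.suc)))

  S : ℕ → Pol
  S n = sumₚ (λ i → (X+ enum i) ^ₚ n)

  H : Pol
  H = Xₚ ^ₚ q +ₚ negₚ Xₚ

  eval-X+ : ∀ a x → eval (X+ a) x ≈ x + a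
  eval-X+ a x = trans (eval-+ₚ Xₚ (constₚ a) x) (+-cong (eval-Xₚ x) (eval-const a x))

  eval-S : ∀ n x → eval (S n) x ≈ σ n
  eval-S n x = begin
    eval (S n) x                              ≈⟨ eval-sumₚ (λ i → (X+ enum i) ^ₚ n) x ⟩
    sum (λ i → eval ((X+ enum i) ^ₚ n) x)     ≈⟨ sum-cong-≋ (λ i → trans (eval-^ₚ (X+ enum i) n x)
                                                                         (^-congˡ n (eval-X+ (enum i) x))) ⟩
    ∑ (λ a → (x + a) ^ n)                     ≈⟨ ∑-+-invariant x (_^ n) (^-congˡ n) ⟩
    σ n                                       ∎
    where open MonoidSum +-commutativeMonoid using (sum-cong-≋)

  eval-H : ∀ x → eval H x ≈ 0#
  eval-H x = begin
    eval H x                                  ≈⟨ eval-+ₚ (Xₚ ^ₚ q) (negₚ Xₚ) x ⟩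
    eval (Xₚ ^ₚ q) x + eval (negₚ Xₚ) x       ≈⟨ +-cong (trans (eval-^ₚ Xₚ q x) (^-congˡ q (eval-Xₚ x)))
                                                         (trans (eval-negₚ Xₚ x) (-‿cong (eval-Xₚ x))) ⟩
    x ^ q + - x                               ≈⟨ +-congʳ (x^q≈x x) ⟩
    x + - x                                   ≈⟨ -‿inverseʳ x ⟩
    0#                                        ∎

  -- Both sides are monic of degree q and agree as functions on F.
  [X+a]^q≈X+a+H : ∀ a → (X+ a) ^ₚ q ≈ₚ X+ a +ₚ H
  [X+a]^q≈X+a+H a = P-Q≈0⇒P≈Q ((X+ a) ^ₚ q) (X+ a +ₚ H) (degree<q∧vanishing⇒≈0 D D<q eval-D)
    where
    D = (X+ a) ^ₚ q +ₚ negₚ (X+ a +ₚ H)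
    coeff-D : ∀ i → coeff D i ≈ coeff ((X+ a) ^ₚ q) i + - (coeff (X+ a) i + (coeff (Xₚ ^ₚ q) i + - coeff Xₚ i))
    coeff-D i = trans (coeff-+ₚ ((X+ a) ^ₚ q) (negₚ (X+ a +ₚ H)) i) (+-congˡ (trans (coeff-negₚ (X+ a +ₚ H) i) (-‿cong
      (trans (coeff-+ₚ (X+ a) H i) (+-congˡ (trans (coeff-+ₚ (Xₚ ^ₚ q) (negₚ Xₚ) i)
                                                   (+-congˡ (coeff-negₚ Xₚ i))))))))
    D<q : Degree< q D
    D<q (suc zero) (s≤s ())
    D<q i@(suc (suc _)) q≤i = begin
      coeff D i                                                  ≈⟨ coeff-D i ⟩
      coeff ((X+ a) ^ₚ q) i + - (0# + (coeff (Xₚ ^ₚ q) i + - 0#)) ≈⟨ +-congˡ (-‿cong (trans (+-identityˡ _)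
                                                                      (trans (+-congˡ -0#≈0#) (+-identityʳ _)))) ⟩
      coeff ((X+ a) ^ₚ q) i + - coeff (Xₚ ^ₚ q) i                ≈⟨ +-congʳ (coeff-[X+a]ⁿ≈coeff-Xⁿ a q i q≤i) ⟩
      coeff (Xₚ ^ₚ q) i + - coeff (Xₚ ^ₚ q) i                    ≈⟨ -‿inverseʳ _ ⟩
      0#                                                         ∎
    eval-D : ∀ x → eval D x ≈ 0#
    eval-D x = begin
      eval D x                                          ≈⟨ eval-+ₚ ((X+ a) ^ₚ q) (negₚ (X+ a +ₚ H)) x ⟩
      eval ((X+ a) ^ₚ q) x + eval (negₚ (X+ a +ₚ H)) x  ≈⟨ +-cong (eval-^ₚ (X+ a) q x)
                                                                  (trans (eval-negₚ (X+ a +ₚ H) x) (-‿cong (eval-+ₚ (X+ a) H x))) ⟩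
      eval (X+ a) x ^ q + - (eval (X+ a) x + eval H x)  ≈⟨ +-cong (x^q≈x (eval (X+ a) x)) (-‿cong (trans (+-congˡ (eval-H x))
                                                                                          (+-identityʳ _))) ⟩
      eval (X+ a) x + - eval (X+ a) x                   ≈⟨ -‿inverseʳ _ ⟩
      0#                                                ∎

  S[q+m]≈S[1+m]+H*S[m] : ∀ m → S (q ℕ.+ m) ≈ₚ S (suc m) +ₚ H *ₚ S m
  S[q+m]≈S[1+m]+H*S[m] m = ≈ₚ-trans (sumₚ-cong term)
    (≈ₚ-trans (sumₚ-distrib-+ₚ (λ i → (X+ enum i) ^ₚ suc m) (λ i → H *ₚ (X+ enum i) ^ₚ m))
              (+ₚ-cong ≈ₚ-refl (≈ₚ-sym (*ₚ-distribˡ-sumₚ H (λ i → (X+ enum i) ^ₚ m)))))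
    where
    term : ∀ i → (X+ enum i) ^ₚ (q ℕ.+ m) ≈ₚ (X+ enum i) ^ₚ suc m +ₚ H *ₚ (X+ enum i) ^ₚ m
    term i = ≈ₚ-trans (^ₚ-homo-*ₚ (X+ enum i) q m) (≈ₚ-trans
      (*ₚ-congˡ ((X+ enum i) ^ₚ m) ([X+a]^q≈X+a+H (enum i)))
      (*ₚ-distribʳ (X+ enum i) H ((X+ enum i) ^ₚ m)))

  S-small : ∀ n → n < q → S n ≈ₚ constₚ (σ n)
  S-small n n<q = P-Q≈0⇒P≈Q (S n) (constₚ (σ n)) (degree<q∧vanishing⇒≈0 D D<q eval-D)
    where
    D = S n +ₚ negₚ (constₚ (σ n))
    D<q : Degree< q D
    D<q (suc i) q≤1+i = begin
      coeff D (suc i)                               ≈⟨ trans (coeff-+ₚ (S n) (negₚ (constₚ (σ n))) (suc i)) (+-identityʳ _) ⟩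
      coeff (S n) (suc i)                           ≈⟨ coeff-sumₚ (λ j → (X+ enum j) ^ₚ n) (suc i) ⟩
      sum (λ j → coeff ((X+ enum j) ^ₚ n) (suc i))  ≈⟨ sum-cong-≋ {q} (λ j → coeff-[X+a]ⁿ->n (enum j) n (suc i)
                                                                      (ℕ.<-≤-trans n<q q≤1+i)) ⟩
      sum {q} (λ _ → 0#)                            ≈⟨ sum-replicate-zero q ⟩
      0#                                            ∎
      where open MonoidSum +-commutativeMonoid using (sum-cong-≋; sum-replicate-zero)
    eval-D : ∀ x → eval D x ≈ 0#
    eval-D x = begin
      eval D x                                     ≈⟨ eval-+ₚ (S n) (negₚ (constₚ (σ n))) x ⟩
      eval (S n) x + eval (negₚ (constₚ (σ n))) x  ≈⟨ +-cong (eval-S n x)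
                                                             (trans (eval-negₚ (constₚ (σ n)) x) (-‿cong (eval-const (σ n) x))) ⟩
      σ n + - σ n                                  ≈⟨ -‿inverseʳ _ ⟩
      0#                                           ∎

  coeff-H-0 : coeff H 0 ≈ 0#
  coeff-H-0 = begin
    coeff H 0                         ≈⟨ trans (coeff-+ₚ (Xₚ ^ₚ q) (negₚ Xₚ) 0) (+-congˡ -0#≈0#) ⟩
    coeff (Xₚ ^ₚ q) 0 + 0#            ≈⟨ +-identityʳ _ ⟩
    coeff (Xₚ ^ₚ q) 0                 ≈⟨ coeff-≈ (Xₚ^ₚn≈shift^n1ₚ q) 0 ⟩
    coeff (shift^ q 1ₚ) 0             ≡⟨ coeff-shift^-< q 1ₚ 0 (s≤s z≤n) ⟩
    0#                                ∎

  sumₚ-elements : ∀ (f : Carrier → Pol) → Defs.sumₚ F (List.map f (Defs.elements F)) ≡ sumₚ (f ∘ enum)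
  sumₚ-elements f = ≡.trans
    (≡.cong (List.foldr _+ₚ_ []) (≡.trans (≡.sym (List.map-∘ {g = f} {f = enum} (List.allFin q))) (List.map-tabulate (λ i → i) (f ∘ enum))))
    (foldr-tabulate (f ∘ enum))
    where
    foldr-tabulate : ∀ {m} (v : Fin m → Pol) → List.foldr _+ₚ_ [] (List.tabulate v) ≡ sumₚ v
    foldr-tabulate {zero}  v = ≡.refl
    foldr-tabulate {suc m} v = ≡.cong (v Fin.zero +ₚ_) (foldr-tabulate (v ∘ Fin.suc))

module Composition {c ℓ q} (F : FiniteField c ℓ q) where
  open FiniteField F
  open FieldProperties F
  open Polynomials F
  open PolynomialProducts F

  compose : Pol → Pol → Pol
  compose = Defs.compose F

  compose-+ₚ : ∀ K A B → compose (A +ₚ B) K ≈ₚ compose A K +ₚ compose B K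
  compose-+ₚ K []      B       = ≈ₚ-refl
  compose-+ₚ K (a ∷ A) []      = ≈ₚ-sym (+ₚ-identityʳ _)
  compose-+ₚ K (a ∷ A) (b ∷ B) = ≈ₚ-trans
    (+ₚ-cong ≈ₚ-refl (≈ₚ-trans (*ₚ-congʳ K (compose-+ₚ K A B)) (*ₚ-distribˡ K (compose A K) (compose B K))))
    (+ₚ-interchange (constₚ a) (constₚ b) (K *ₚ compose A K) (K *ₚ compose B K))

  compose-negₚ : ∀ K A → compose (negₚ A) K ≈ₚ negₚ (compose A K)
  compose-negₚ K []      = ≈ₚ-refl
  compose-negₚ K (a ∷ A) = ≈ₚ-trans
    (+ₚ-cong ≈ₚ-refl (≈ₚ-trans (*ₚ-congʳ K (compose-negₚ K A)) (*ₚ-negₚʳ K (compose A K))))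
    (negₚ-+ₚ-comm (constₚ a) (K *ₚ compose A K))

  compose-shift : ∀ K B → compose (shift B) K ≈ₚ K *ₚ compose B K
  compose-shift K B = coeffwise λ i → trans (coeff-+ₚ (constₚ 0#) (K *ₚ compose B K) i) (trans (+-congʳ (const0≈0 i)) (+-identityˡ _))
    where
    const0≈0 : ∀ i → coeff (constₚ 0#) i ≈ 0#
    const0≈0 zero    = refl
    const0≈0 (suc i) = refl

  coeff-*ₚ-0 : ∀ P Q → coeff (P *ₚ Q) 0 ≈ coeff P 0 * coeff Q 0
  coeff-*ₚ-0 []      Q = sym (zeroˡ _)
  coeff-*ₚ-0 (a ∷ P) Q = trans (coeff-+ₚ (scale a Q) (shift (P *ₚ Q)) 0) (trans (+-identityʳ _) (coeff-scale a Q 0))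

  -- Comparing coefficients in X^m C = X C expresses each coefficient of C through one of lower index.
  [X^[2+k]-X]*C≈0⇒C≈0 : ∀ k C → (Xₚ ^ₚ (2 ℕ.+ k) +ₚ negₚ Xₚ) *ₚ C ≈ₚ [] → C ≈ₚ []
  [X^[2+k]-X]*C≈0⇒C≈0 k C KC≈0 = coeffwise (<-rec _ coeff≈0)
    where
    m = 2 ℕ.+ k
    KC≈shift^-shift : (Xₚ ^ₚ m +ₚ negₚ Xₚ) *ₚ C ≈ₚ shift^ m C +ₚ negₚ (shift C)
    KC≈shift^-shift = ≈ₚ-trans (*ₚ-distribʳ (Xₚ ^ₚ m) (negₚ Xₚ) C)
      (+ₚ-cong (Xₚ^ₚn*ₚP≈shift^nP m C) (≈ₚ-trans (*ₚ-negₚˡ Xₚ C) (negₚ-cong (Xₚ*ₚP≈shiftP C))))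
    coeff-C : ∀ i → coeff (shift^ m C) (suc i) ≈ coeff C i
    coeff-C i = x∙y⁻¹≈ε⇒x≈y _ _ (begin
      coeff (shift^ m C) (suc i) + - coeff C i           ≈⟨ +-congˡ (coeff-negₚ (shift C) (suc i)) ⟨
      coeff (shift^ m C) (suc i) + coeff (negₚ (shift C)) (suc i)
                                                         ≈⟨ coeff-+ₚ (shift^ m C) (negₚ (shift C)) (suc i) ⟨
      coeff (shift^ m C +ₚ negₚ (shift C)) (suc i)       ≈⟨ coeff-≈ (≈ₚ-trans (≈ₚ-sym KC≈shift^-shift) KC≈0) (suc i) ⟩
      0#                                                 ∎)
      where open SetoidReasoning setoid
    coeff≈0 : ∀ i → (∀ {j} → j < i → coeff C j ≈ 0#) → coeff C i ≈ 0#
    coeff≈0 i ih with m ℕ.≤? suc i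
    ... | no  m≰1+i = trans (sym (coeff-C i)) (reflexive (coeff-shift^-< m C (suc i) (ℕ.≰⇒> m≰1+i)))
    ... | yes m≤1+i = trans (sym (coeff-C i))
      (trans (reflexive (≡.trans (≡.cong (coeff (shift^ m C)) (≡.sym m+j≡1+i)) (coeff-shift^-+ m C j)))
             (ih j<i))
      where
      j = suc i ∸ m
      m+j≡1+i : m ℕ.+ j ≡ suc i
      m+j≡1+i = ℕ.m+[n∸m]≡n m≤1+i
      j<i : j < i
      j<i = ≡.subst (suc j ≤_) (ℕ.suc-injective m+j≡1+i) (s≤s (ℕ.m≤n+m j k))

  compose≈0⇒≈0 : ∀ K → coeff K 0 ≈ 0# → (∀ C → K *ₚ C ≈ₚ [] → C ≈ₚ []) → ∀ D → compose D K ≈ₚ [] → D ≈ₚ []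
  compose≈0⇒≈0 K K₀≈0 K-cancel []      _         = ≈ₚ-refl
  compose≈0⇒≈0 K K₀≈0 K-cancel (d ∷ D) D[K]≈0 = coeffwise λ
    { zero    → d≈0
    ; (suc i) → coeff-≈ (compose≈0⇒≈0 K K₀≈0 K-cancel D (K-cancel (compose D K) K*D[K]≈0)) i }
    where
    d≈0 : d ≈ 0#
    d≈0 = trans (sym (trans (+-congˡ (trans (coeff-*ₚ-0 K (compose D K)) (trans (*-congʳ K₀≈0) (zeroˡ _))))
                            (+-identityʳ d)))
                (trans (sym (coeff-+ₚ (constₚ d) (K *ₚ compose D K) 0)) (coeff-≈ D[K]≈0 0))
    K*D[K]≈0 : K *ₚ compose D K ≈ₚ []
    K*D[K]≈0 = ≈ₚ-trans (+ₚ-cong {[]} {constₚ d} (coeffwise λ { zero → sym d≈0 ; (suc i) → refl }) ≈ₚ-refl)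
                        D[K]≈0

  compose-injective : ∀ K → coeff K 0 ≈ 0# → (∀ C → K *ₚ C ≈ₚ [] → C ≈ₚ [])
                    → ∀ G G′ → compose G K ≈ₚ compose G′ K → G ≈ₚ G′
  compose-injective K K₀≈0 K-cancel G G′ G[K]≈G′[K] = P-Q≈0⇒P≈Q G G′
    (compose≈0⇒≈0 K K₀≈0 K-cancel (G +ₚ negₚ G′) (≈ₚ-trans (compose-+ₚ K G (negₚ G′))
      (≈ₚ-trans (+ₚ-cong G[K]≈G′[K] (compose-negₚ K G′)) (+ₚ-inverseʳ (compose G′ K)))))

module SeriesCoefficients {c ℓ q₂} (F : FiniteField c ℓ (2 ℕ.+ q₂)) where
  open FiniteField F
  open FieldProperties F
  open SetoidReasoning setoid

  a : ℕ → Carrier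
  a = seriesCoeff F

  private
    q₁ : ℕ
    q₁ = suc q₂

    history : ℕ → List Carrier
    history = Defs.history F

    coeff : List Carrier → ℕ → Carrier
    coeff = Defs.coeff F

    indicator : Bool → Carrier
    indicator b = if b then - 1# else 0#

    a-suc : ∀ m → a (suc m) ≡ indicator (suc m ℕ.≡ᵇ q₁) + (coeff (history m) q₂ + coeff (history m) q₁)
    a-suc m = ≡.refl

    coeff-history-≤ : ∀ m j → j ≤ m → coeff (history m) j ≡ a (m ∸ j)
    coeff-history-≤ zero    zero    _         = ≡.refl
    coeff-history-≤ (suc m) zero    _         = ≡.refl
    coeff-history-≤ (suc m) (suc j) (s≤s j≤m) = coeff-history-≤ m j j≤m

    coeff-history-> : ∀ m j → m < j → coeff (history m) j ≡ 0#
    coeff-history-> zero    (suc j) _         = ≡.refl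
    coeff-history-> (suc m) (suc j) (s≤s m<j) = coeff-history-> m j m<j

    ≡ᵇ-refl : ∀ n → (n ℕ.≡ᵇ n) ≡ true
    ≡ᵇ-refl zero    = ≡.refl
    ≡ᵇ-refl (suc n) = ≡ᵇ-refl n

    ≢⇒≡ᵇ-false : ∀ m n → m ≢ n → (m ℕ.≡ᵇ n) ≡ false
    ≢⇒≡ᵇ-false zero    zero    m≢n = ⊥-elim (m≢n ≡.refl)
    ≢⇒≡ᵇ-false zero    (suc n) _   = ≡.refl
    ≢⇒≡ᵇ-false (suc m) zero    _   = ≡.refl
    ≢⇒≡ᵇ-false (suc m) (suc n) m≢n = ≢⇒≡ᵇ-false m n (m≢n ∘ ≡.cong suc)

  a[q+m]≈a[1+m]+a[m] : ∀ m → a (2 ℕ.+ q₂ ℕ.+ m) ≈ a (suc m) + a m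
  a[q+m]≈a[1+m]+a[m] m = begin
    a (suc M)                                                            ≡⟨ a-suc M ⟩
    indicator (suc M ℕ.≡ᵇ q₁) + (coeff (history M) q₂ + coeff (history M) q₁)
      ≡⟨ ≡.cong₂ (λ b x → indicator b + x) (≢⇒≡ᵇ-false (suc M) q₁ 1+M≢q₁)
                 (≡.cong₂ _+_ coeff-q₂ coeff-q₁) ⟩
    0# + (a (suc m) + a m)                                               ≈⟨ +-identityˡ _ ⟩
    a (suc m) + a m                                                      ∎
    where
    M = q₁ ℕ.+ m
    1+M≢q₁ : suc M ≢ q₁
    1+M≢q₁ 1+M≡q₁ = ℕ.<-irrefl (≡.sym 1+M≡q₁) (s≤s (s≤s (ℕ.m≤m+n q₂ m)))
    coeff-q₂ : coeff (history M) q₂ ≡ a (suc m)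
    coeff-q₂ = ≡.trans (coeff-history-≤ M q₂ (ℕ.m≤n⇒m≤1+n (ℕ.m≤m+n q₂ m)))
                       (≡.cong a (≡.trans (≡.cong (_∸ q₂) (≡.sym (ℕ.+-suc q₂ m))) (ℕ.m+n∸m≡n q₂ (suc m))))
    coeff-q₁ : coeff (history M) q₁ ≡ a m
    coeff-q₁ = ≡.trans (coeff-history-≤ M q₁ (s≤s (ℕ.m≤m+n q₂ m))) (≡.cong a (ℕ.m+n∸m≡n q₂ m))

  a-small : ∀ n → n < q₁ → a n ≈ 0#
  a-small zero    _         = refl
  a-small (suc m) (s≤s m<q₂) = begin
    a (suc m)                                                                ≡⟨ a-suc m ⟩
    indicator (suc m ℕ.≡ᵇ q₁) + (coeff (history m) q₂ + coeff (history m) q₁)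
      ≡⟨ ≡.cong₂ (λ b x → indicator b + x) (≢⇒≡ᵇ-false (suc m) q₁ λ 1+m≡q₁ → ℕ.<-irrefl (ℕ.suc-injective 1+m≡q₁) m<q₂)
                 (≡.cong₂ _+_ (coeff-history-> m q₂ m<q₂) (coeff-history-> m q₁ (ℕ.m<n⇒m<1+n m<q₂))) ⟩
    0# + (0# + 0#)                                                           ≈⟨ trans (+-identityˡ _) (+-identityˡ 0#) ⟩
    0#                                                                       ∎

  a[q₁]≈-1 : a q₁ ≈ - 1#
  a[q₁]≈-1 = begin
    a q₁                                                                     ≡⟨ a-suc q₂ ⟩
    indicator (q₁ ℕ.≡ᵇ q₁) + (coeff (history q₂) q₂ + coeff (history q₂) q₁)
      ≡⟨ ≡.cong₂ (λ b x → indicator b + x) (≡ᵇ-refl q₁)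
                 (≡.cong₂ _+_ (≡.trans (coeff-history-≤ q₂ q₂ ℕ.≤-refl) (≡.cong a (ℕ.n∸n≡0 q₂)))
                              (coeff-history-> q₂ q₁ ℕ.≤-refl)) ⟩
    - 1# + (0# + 0#)                                                         ≈⟨ trans (+-congˡ (+-identityˡ 0#)) (+-identityʳ _) ⟩
    - 1#                                                                     ∎

module GPolynomials {c ℓ q₂} (F : FiniteField c ℓ (2 ℕ.+ q₂)) where
  open FiniteField F
  open FieldProperties F
  open Polynomials F
  open PolynomialProducts F
  open Evaluation F
  open FiniteSums F
  open PowerSums F
  open TranslateSums F
  open Composition F
  open SeriesCoefficients F
  open SetoidReasoning setoid
  open import Algebra.Solver.Ring.NaturalCoefficients.Default commutativeSemiring
    using (solve; _:=_; _:+_; _:*_)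

  q₁ : ℕ
  q₁ = suc q₂

  record GWithValues (n : ℕ) : Set (c ⊔ ℓ) where
    field
      g          : Pol
      g[H]≈S     : compose g H ≈ₚ S n
      g-on-units : ∀ y → y ≉ 0# → eval g y ≈ a n * y ^ n
      g-0-∤      : ¬ (q₁ ∣ n) → eval g 0# ≈ 0#
      g-0-∣      : 1 ≤ n → q₁ ∣ n → eval g 0# ≈ - 1#

  IsG⇒G[H]≈S : ∀ n G → IsG F n G → compose G H ≈ₚ S n
  IsG⇒G[H]≈S n G isG = coeffwise λ i → sym (≡.subst (λ P → coeff P i ≈ coeff (compose G H) i)
                                                    (sumₚ-elements (λ b → (X+ b) ^ₚ n)) (isG i))

  compose-const : ∀ b → compose (constₚ b) H ≈ₚ constₚ b
  compose-const b = ≈ₚ-trans (+ₚ-cong ≈ₚ-refl (*ₚ-zeroʳ H [] ≈ₚ-refl)) (+ₚ-identityʳ (constₚ b))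

  gWithValues-q₁ : GWithValues q₁
  gWithValues-q₁ = record
    { g          = constₚ (- 1#)
    ; g[H]≈S     = ≈ₚ-trans (compose-const (- 1#)) (≈ₚ-sym (≈ₚ-trans (S-small q₁ ℕ.≤-refl)
                     (coeffwise λ { zero → σ[q₁]≈-1 ; (suc i) → refl })))
    ; g-on-units = λ y y≉0 → trans (eval-const (- 1#) y)
                     (sym (trans (*-cong a[q₁]≈-1 (x^q₁≈1 y≉0)) (*-identityʳ _)))
    ; g-0-∤      = λ q₁∤q₁ → ⊥-elim (q₁∤q₁ n∣n)
    ; g-0-∣      = λ _ _ → eval-const (- 1#) 0#
    }
    where
    σ[q₁]≈-1 : σ q₁ ≈ - 1#
    σ[q₁]≈-1 = ≡.subst (λ j → σ j ≈ - 1#) (ℕ.*-identityˡ q₁) (σ[1+t*q₁]≈-1 0)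

  gWithValues-< : ∀ n → n < q₁ → GWithValues n
  gWithValues-< n n<q₁ = record
    { g          = []
    ; g[H]≈S     = ≈ₚ-sym (≈ₚ-trans (S-small n (ℕ.m<n⇒m<1+n n<q₁))
                     (coeffwise λ { zero → σ-small n n<q₁ ; (suc i) → refl }))
    ; g-on-units = λ y _ → sym (trans (*-congʳ (a-small n n<q₁)) (zeroˡ _))
    ; g-0-∤      = λ _ → refl
    ; g-0-∣      = λ 1≤n q₁∣n → ⊥-elim (ℕ.<-irrefl ≡.refl (ℕ.<-≤-trans n<q₁ (∣⇒≤ ⦃ ℕ.>-nonZero 1≤n ⦄ q₁∣n)))
    }

  gWithValues-step : ∀ m → GWithValues (suc m) → GWithValues m → GWithValues (q ℕ.+ m)
  gWithValues-step m G₁ G₀ = record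
    { g          = g₁ +ₚ shift g₀
    ; g[H]≈S     = ≈ₚ-trans (compose-+ₚ H g₁ (shift g₀))
                     (≈ₚ-trans (+ₚ-cong G₁.g[H]≈S (≈ₚ-trans (compose-shift H g₀) (*ₚ-congʳ H G₀.g[H]≈S)))
                               (≈ₚ-sym (S[q+m]≈S[1+m]+H*S[m] m)))
    ; g-on-units = on-units
    ; g-0-∤      = λ q₁∤q+m → trans g[0]≈g₁[0] (G₁.g-0-∤ (q₁∤q+m ∘ ∣q₁+[1+m]))
    ; g-0-∣      = λ _ q₁∣q+m → trans g[0]≈g₁[0] (G₁.g-0-∣ (s≤s z≤n) (∣m+n∣m⇒∣n (≡.subst (q₁ ∣_) q+m≡q₁+[1+m] q₁∣q+m) n∣n))
    }
    where
    module G₁ = GWithValues G₁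
    module G₀ = GWithValues G₀
    g₁ = G₁.g
    g₀ = G₀.g
    q+m≡q₁+[1+m] : q ℕ.+ m ≡ q₁ ℕ.+ suc m
    q+m≡q₁+[1+m] = ≡.cong suc (≡.sym (ℕ.+-suc q₂ m))
    ∣q₁+[1+m] : q₁ ∣ suc m → q₁ ∣ q ℕ.+ m
    ∣q₁+[1+m] q₁∣1+m = ≡.subst (q₁ ∣_) (≡.sym q+m≡q₁+[1+m]) (∣m∣n⇒∣m+n n∣n q₁∣1+m)
    eval-g : ∀ y → eval (g₁ +ₚ shift g₀) y ≈ eval g₁ y + y * eval g₀ y
    eval-g y = trans (eval-+ₚ g₁ (shift g₀) y) (+-congˡ (+-identityˡ _))
    g[0]≈g₁[0] : eval (g₁ +ₚ shift g₀) 0# ≈ eval g₁ 0#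
    g[0]≈g₁[0] = trans (eval-g 0#) (trans (+-congˡ (zeroˡ _)) (+-identityʳ _))
    on-units : ∀ y → y ≉ 0# → eval (g₁ +ₚ shift g₀) y ≈ a (q ℕ.+ m) * y ^ (q ℕ.+ m)
    on-units y y≉0 = begin
      eval (g₁ +ₚ shift g₀) y                          ≈⟨ eval-g y ⟩
      eval g₁ y + y * eval g₀ y                        ≈⟨ +-cong (G₁.g-on-units y y≉0) (*-congˡ (G₀.g-on-units y y≉0)) ⟩
      a (suc m) * (y * y ^ m) + y * (a m * y ^ m)      ≈⟨ solve 4 (λ a₁ a₀ y z → a₁ :* (y :* z) :+ y :* (a₀ :* z)
                                                                         := (a₁ :+ a₀) :* (y :* z))
                                                              refl (a (suc m)) (a m) y (y ^ m) ⟩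
      (a (suc m) + a m) * y ^ suc m                    ≈⟨ *-cong (sym (a[q+m]≈a[1+m]+a[m] m)) (sym (*-identityˡ _)) ⟩
      a (q ℕ.+ m) * (1# * y ^ suc m)                   ≈⟨ *-congˡ (*-congʳ (sym (x^q₁≈1 y≉0))) ⟩
      a (q ℕ.+ m) * (y ^ q₁ * y ^ suc m)               ≈⟨ *-congˡ (sym (^-homo-* y q₁ (suc m))) ⟩
      a (q ℕ.+ m) * y ^ (q₁ ℕ.+ suc m)                 ≡⟨ ≡.cong (λ e → a (q ℕ.+ m) * y ^ e) (≡.sym q+m≡q₁+[1+m]) ⟩
      a (q ℕ.+ m) * y ^ (q ℕ.+ m)                      ∎

  -- Strong induction: n ≥ q reduces to n - q + 1 and n - q, and n ≤ q₁ are the base cases.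
  gWithValues : ∀ n → GWithValues n
  gWithValues = <-rec GWithValues build
    where
    build : ∀ n → (∀ {m} → m < n → GWithValues m) → GWithValues n
    build n rec with q ℕ.≤? n
    ... | yes q≤n = ≡.subst GWithValues q+m≡n (gWithValues-step m (rec 1+m<n) (rec (ℕ.<⇒≤ 1+m<n)))
      where
      m = n ∸ q
      q+m≡n : q ℕ.+ m ≡ n
      q+m≡n = ℕ.m+[n∸m]≡n q≤n
      1+m<n : suc m < n
      1+m<n = ≡.subst (suc m <_) q+m≡n (s≤s (s≤s (ℕ.m≤n+m m q₂)))
    ... | no q≰n with ℕ.m≤n⇒m<n∨m≡n (ℕ.≤-pred (ℕ.≰⇒> q≰n))
    ...   | inj₁ n<q₁   = gWithValues-< n n<q₁
    ...   | inj₂ ≡.refl = gWithValues-q₁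

gcd≢1⇒small-multiple : ∀ n N → 1 ≤ n → 1 ≤ N → gcd n N ≢ 1
                     → Σ ℕ λ m → m < N × Σ ℕ λ t → m ℕ.* n ≡ suc t ℕ.* N
gcd≢1⇒small-multiple n N 1≤n 1≤N gcd≢1 with gcd[m,n]∣n n N | gcd[m,n]∣m n N
... | divides m N≡m*d | divides t′ n≡t′*d = m , m<N , t , m*n≡[1+t]*N
  where
  d = gcd n N
  1≤m : 1 ≤ m
  1≤m = ℕ.n≢0⇒n>0 λ { ≡.refl → ℕ.<⇒≢ 1≤N (≡.sym N≡m*d) }
  d≢0 : d ≢ 0
  d≢0 d≡0 = ℕ.<⇒≢ 1≤N (≡.sym (≡.trans N≡m*d (≡.trans (≡.cong (m ℕ.*_) d≡0) (ℕ.*-zeroʳ m))))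
  1<d : 1 < d
  1<d = ℕ.≤∧≢⇒< (ℕ.n≢0⇒n>0 d≢0) (gcd≢1 ∘ ≡.sym)
  m<N : m < N
  m<N = ≡.subst (m <_) (≡.sym N≡m*d) (ℕ.m<m*n m d ⦃ ℕ.>-nonZero 1≤m ⦄ 1<d)
  t = t′ ∸ 1
  1+t≡t′ : suc t ≡ t′
  1+t≡t′ = ℕ.suc-pred t′ ⦃ ℕ.>-nonZero (ℕ.n≢0⇒n>0 λ { ≡.refl → ℕ.<⇒≢ 1≤n (≡.sym n≡t′*d) }) ⦄
  m*n≡[1+t]*N : m ℕ.* n ≡ suc t ℕ.* N
  m*n≡[1+t]*N = begin
    m ℕ.* n           ≡⟨ ≡.cong (m ℕ.*_) n≡t′*d ⟩
    m ℕ.* (t′ ℕ.* d)  ≡⟨ ℕ.*-assoc m t′ d ⟨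
    m ℕ.* t′ ℕ.* d    ≡⟨ ≡.cong (ℕ._* d) (ℕ.*-comm m t′) ⟩
    t′ ℕ.* m ℕ.* d    ≡⟨ ℕ.*-assoc t′ m d ⟩
    t′ ℕ.* (m ℕ.* d)  ≡⟨ ≡.cong₂ ℕ._*_ (≡.sym 1+t≡t′) (≡.sym N≡m*d) ⟩
    suc t ℕ.* N       ∎
    where open ≡.≡-Reasoning

third-element : ∀ {m} → 3 ≤ m → (i j : Fin m) → Σ (Fin m) λ k → k ≢ i × k ≢ j
third-element (s≤s (s≤s (s≤s _))) Fin.zero             Fin.zero             = Fin.suc Fin.zero , (λ ()) , (λ ())
third-element (s≤s (s≤s (s≤s _))) Fin.zero             (Fin.suc Fin.zero)    = Fin.suc (Fin.suc Fin.zero) , (λ ()) , (λ ())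
third-element (s≤s (s≤s (s≤s _))) Fin.zero             (Fin.suc (Fin.suc _)) = Fin.suc Fin.zero , (λ ()) , (λ ())
third-element (s≤s (s≤s (s≤s _))) (Fin.suc Fin.zero)    Fin.zero             = Fin.suc (Fin.suc Fin.zero) , (λ ()) , (λ ())
third-element (s≤s (s≤s (s≤s _))) (Fin.suc (Fin.suc _)) Fin.zero             = Fin.suc Fin.zero , (λ ()) , (λ ())
third-element (s≤s (s≤s (s≤s _))) (Fin.suc _)          (Fin.suc _)          = Fin.zero , (λ ()) , (λ ())

≢⇒≡opposite : ∀ {i k : Fin 2} → i ≢ k → i ≡ Fin.opposite k
≢⇒≡opposite {Fin.zero}           {Fin.zero}           i≢k = ⊥-elim (i≢k ≡.refl)
≢⇒≡opposite {Fin.zero}           {Fin.suc Fin.zero}   _   = ≡.refl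
≢⇒≡opposite {Fin.suc Fin.zero}   {Fin.zero}           _   = ≡.refl
≢⇒≡opposite {Fin.suc Fin.zero}   {Fin.suc Fin.zero}   i≢k = ⊥-elim (i≢k ≡.refl)

module PermutationCriterion {c ℓ q₂} (F : FiniteField c ℓ (2 ℕ.+ q₂))
                            (n : ℕ) (1≤n : 1 ≤ n) (G : Poly F) (isG : IsG F n G) where
  open FiniteField F
  open FieldProperties F
  open Polynomials F
  open Evaluation F
  open FiniteSums F
  open PowerSums F
  open TranslateSums F
  open Composition F
  open SeriesCoefficients F
  open GPolynomials F
  open import Algebra.Properties.Semiring.Sum semiring using (sum-cong-≋; *-distribˡ-sum)
  open SetoidReasoning setoid

  private
    module Gₙ = GWithValues (gWithValues n)

  G≈g : G ≈ₚ Gₙ.g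
  G≈g = compose-injective H coeff-H-0 ([X^[2+k]-X]*C≈0⇒C≈0 q₂) G Gₙ.g
          (≈ₚ-trans (IsG⇒G[H]≈S n G isG) (≈ₚ-sym Gₙ.g[H]≈S))

  φ : Carrier → Carrier
  φ = eval G

  φ-cong : ∀ {x y} → x ≈ y → φ x ≈ φ y
  φ-cong = eval-congʳ G

  φ-on-units : ∀ y → y ≉ 0# → φ y ≈ a n * y ^ n
  φ-on-units y y≉0 = trans (eval-cong y G≈g) (Gₙ.g-on-units y y≉0)

  φ-0-∣ : q₁ ∣ n → φ 0# ≈ - 1#
  φ-0-∣ q₁∣n = trans (eval-cong 0# G≈g) (Gₙ.g-0-∣ 1≤n q₁∣n)

  φ≈a*xⁿ : ¬ (q₁ ∣ n) → ∀ y → φ y ≈ a n * y ^ n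
  φ≈a*xⁿ q₁∤n y with y ≟ 0#
  ... | no  y≉0 = φ-on-units y y≉0
  ... | yes y≈0 = trans (φ-cong y≈0) (trans (trans (eval-cong 0# G≈g) (Gₙ.g-0-∤ q₁∤n))
                    (sym (trans (*-congˡ (trans (^-congˡ n y≈0) (0^n≈0 1≤n))) (zeroʳ _))))

  IsPP⇒∑φ^m≈σm : IsPP F G → ∀ m → ∑ (λ y → φ y ^ m) ≈ σ m
  IsPP⇒∑φ^m≈σm (φ-inj , φ-surj) m = ∑-bijection φ ψ φ-cong ψ-cong φψ≈id ψφ≈id (_^ m) (^-congˡ m)
    where
    ψ : Carrier → Carrier
    ψ y = proj₁ (φ-surj y)
    φψ≈id : ∀ y → φ (ψ y) ≈ y
    φψ≈id y = proj₂ (φ-surj y)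
    ψφ≈id : ∀ x → ψ (φ x) ≈ x
    ψφ≈id x = φ-inj _ _ (φψ≈id (φ x))
    ψ-cong : ∀ {x y} → x ≈ y → ψ x ≈ ψ y
    ψ-cong {x} {y} x≈y = φ-inj _ _ (trans (φψ≈id x) (trans x≈y (sym (φψ≈id y))))

  constant-on-units⇒¬IsPP : 3 ≤ q → ∀ b → (∀ y → y ≉ 0# → φ y ≈ b) → ¬ IsPP F G
  constant-on-units⇒¬IsPP 3≤q b φ≈b (φ-inj , _) = y≢1 (enum-inj y (index 1#)
    (trans (φ-inj (enum y) 1# (trans (φ≈b _ y≉0) (sym (φ≈b 1# 1≉0)))) (sym (enum-index 1#))))
    where
    third = third-element 3≤q (index 0#) (index 1#)
    y = proj₁ third
    y≢0 = proj₁ (proj₂ third)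
    y≢1 = proj₂ (proj₂ third)
    y≉0 : enum y ≉ 0#
    y≉0 y≈0 = y≢0 (enum-inj y (index 0#) (trans y≈0 (sym (enum-index 0#))))

  module _ (3≤q : 3 ≤ q) where

    IsPP⇒q₁∤n : IsPP F G → ¬ (q₁ ∣ n)
    IsPP⇒q₁∤n pp (divides t n≡t*q₁) = constant-on-units⇒¬IsPP 3≤q (a n) φ≈a pp
      where
      φ≈a : ∀ y → y ≉ 0# → φ y ≈ a n
      φ≈a y y≉0 = trans (φ-on-units y y≉0) (trans (*-congˡ (trans (^-congʳ y n≡t*q₁) (x^[t*q₁]≈1 t y≉0)))
                                                   (*-identityʳ _))

    IsPP⇒a≉0 : IsPP F G → a n ≉ 0#
    IsPP⇒a≉0 pp a≈0 = constant-on-units⇒¬IsPP 3≤q 0# (λ y y≉0 → trans (φ-on-units y y≉0)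
      (trans (*-congʳ a≈0) (zeroˡ _))) pp

    -- For d = gcd n q₁ > 1 and m = q₁ / d, ∑ φ(y)ᵐ is both σ m = 0 and aᵐ σ((n/d) q₁) = - aᵐ.
    IsPP⇒gcd≡1 : IsPP F G → gcd n q₁ ≡ 1
    IsPP⇒gcd≡1 pp with gcd n q₁ ℕ.≟ 1
    ... | yes gcd≡1 = gcd≡1
    ... | no  gcd≢1 with gcd≢1⇒small-multiple n q₁ 1≤n (s≤s z≤n) gcd≢1
    ...   | m , m<q₁ , t , m*n≡[1+t]*q₁ =
      ⊥-elim (IsPP⇒a≉0 pp (x^n≈0⇒x≈0 m (x*y≈0⇒y≈0 -1≉0 (begin
        - 1# * a n ^ m                  ≈⟨ *-comm _ _ ⟩
        a n ^ m * - 1#                  ≈⟨ *-congˡ (σ[1+t*q₁]≈-1 t) ⟨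
        a n ^ m * σ (suc t ℕ.* q₁)      ≡⟨ ≡.cong (λ e → a n ^ m * σ e) (≡.sym m*n≡[1+t]*q₁) ⟩
        a n ^ m * σ (m ℕ.* n)           ≈⟨ *-distribˡ-sum (a n ^ m) (λ i → enum i ^ (m ℕ.* n)) ⟩
        ∑ (λ y → a n ^ m * y ^ (m ℕ.* n)) ≈⟨ sum-cong-≋ (λ i → sym (φ^m (enum i))) ⟩
        ∑ (λ y → φ y ^ m)               ≈⟨ IsPP⇒∑φ^m≈σm pp m ⟩
        σ m                             ≈⟨ σ-small m m<q₁ ⟩
        0#                              ∎))))
      where
      φ^m : ∀ y → φ y ^ m ≈ a n ^ m * y ^ (m ℕ.* n)
      φ^m y = begin
        φ y ^ m               ≈⟨ ^-congˡ m (φ≈a*xⁿ (IsPP⇒q₁∤n pp) y) ⟩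
        (a n * y ^ n) ^ m     ≈⟨ ^-distrib-* (a n) (y ^ n) m ⟩
        a n ^ m * (y ^ n) ^ m ≈⟨ *-congˡ (trans (^-assocʳ y n m) (^-congʳ y (ℕ.*-comm n m))) ⟩
        a n ^ m * y ^ (m ℕ.* n) ∎

    gcd≡1∧a≉0⇒IsPP : gcd n q₁ ≡ 1 → a n ≉ 0# → IsPP F G
    gcd≡1∧a≉0⇒IsPP gcd≡1 a≉0 = φ-inj , φ-surj
      where
      q₁∤n : ¬ (q₁ ∣ n)
      q₁∤n q₁∣n = ℕ.<-irrefl (≡.sym (∣1⇒≡1 (≡.subst (q₁ ∣_) gcd≡1 (gcd-greatest q₁∣n n∣n)))) (ℕ.≤-pred 3≤q)
      φ-inj : ∀ x y → φ x ≈ φ y → x ≈ y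
      φ-inj x y φx≈φy = coprime⇒^-injective n 1≤n gcd≡1
        (*-cancelˡ a≉0 (trans (sym (φ≈a*xⁿ q₁∤n x)) (trans φx≈φy (φ≈a*xⁿ q₁∤n y))))
      φ-surj : ∀ w → Σ Carrier λ x → φ x ≈ w
      φ-surj w with inverse (a n) a≉0
      ... | a⁻¹ , a*a⁻¹≈1 with coprime⇒^-surjective n 1≤n gcd≡1 (a⁻¹ * w)
      ...   | x , xⁿ≈a⁻¹w = x , (begin
        φ x                ≈⟨ φ≈a*xⁿ q₁∤n x ⟩
        a n * x ^ n        ≈⟨ *-congˡ xⁿ≈a⁻¹w ⟩
        a n * (a⁻¹ * w)    ≈⟨ *-assoc _ _ _ ⟨
        (a n * a⁻¹) * w    ≈⟨ trans (*-congʳ a*a⁻¹≈1) (*-identityˡ w) ⟩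
        w                  ∎)

module PermutationCriterion₂ {c ℓ} (F : FiniteField c ℓ 2) (n : ℕ) (1≤n : 1 ≤ n) (G : Poly F) (isG : IsG F n G) where
  open FiniteField F
  open FieldProperties F
  open FiniteSums F
  open SeriesCoefficients F
  open PermutationCriterion F n 1≤n G isG

  0-or-1 : ∀ y → y ≈ 0# ⊎ y ≈ 1#
  0-or-1 y with y ≟ 0#
  ... | yes y≈0 = inj₁ y≈0
  ... | no  y≉0 = inj₂ (index-≡⇒≈ (≡.trans (≢⇒≡opposite (y≉0 ∘ index-≡⇒≈)) (≡.sym (≢⇒≡opposite (1≉0 ∘ index-≡⇒≈)))))

  φ0≈1 : φ 0# ≈ 1#
  φ0≈1 = trans (φ-0-∣ (1∣ n)) (trans (sym q₁·1≈-1) (+-identityʳ 1#))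

  φ1≈a : φ 1# ≈ a n
  φ1≈a = trans (φ-on-units 1# 1≉0) (trans (*-congˡ (1^n≈1 n)) (*-identityʳ _))

  IsPP⇒a≈0 : IsPP F G → a n ≈ 0#
  IsPP⇒a≈0 (φ-inj , _) with 0-or-1 (a n)
  ... | inj₁ a≈0 = a≈0
  ... | inj₂ a≈1 = ⊥-elim (1≉0 (sym (φ-inj 0# 1# (trans φ0≈1 (sym (trans φ1≈a a≈1))))))

  -- φ swaps 0 and 1.
  a≈0⇒IsPP : a n ≈ 0# → IsPP F G
  a≈0⇒IsPP a≈0 = φ-inj , φ-surj
    where
    φ1≈0 : φ 1# ≈ 0#
    φ1≈0 = trans φ1≈a a≈0
    φ-inj : ∀ x y → φ x ≈ φ y → x ≈ y
    φ-inj x y φx≈φy with 0-or-1 x | 0-or-1 y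
    ... | inj₁ x≈0 | inj₁ y≈0 = trans x≈0 (sym y≈0)
    ... | inj₂ x≈1 | inj₂ y≈1 = trans x≈1 (sym y≈1)
    ... | inj₁ x≈0 | inj₂ y≈1 = ⊥-elim (1≉0 (trans (sym (trans (φ-cong x≈0) φ0≈1)) (trans φx≈φy (trans (φ-cong y≈1) φ1≈0))))
    ... | inj₂ x≈1 | inj₁ y≈0 = ⊥-elim (1≉0 (trans (sym (trans (φ-cong y≈0) φ0≈1)) (trans (sym φx≈φy) (trans (φ-cong x≈1) φ1≈0))))
    φ-surj : ∀ w → Σ Carrier λ x → φ x ≈ w
    φ-surj w with 0-or-1 w
    ... | inj₁ w≈0 = 1# , trans φ1≈0 (sym w≈0)
    ... | inj₂ w≈1 = 0# , trans φ0≈1 (sym w≈1)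

criterion-q>2 : ∀ {c ℓ q₂} (F : FiniteField c ℓ (2 ℕ.+ q₂)) n → 1 ≤ n → (G : Poly F) → IsG F n G → 2 < 2 ℕ.+ q₂
              → IsPP F G ⇔ (gcd n (suc q₂) ≡ 1 × ¬ (FiniteField._≈_ F (seriesCoeff F n) (FiniteField.0# F)))
criterion-q>2 F n 1≤n G isG 3≤q = mk⇔ (λ pp → IsPP⇒gcd≡1 3≤q pp , IsPP⇒a≉0 3≤q pp)
                                      (λ (gcd≡1 , a≉0) → gcd≡1∧a≉0⇒IsPP 3≤q gcd≡1 a≉0)
  where open PermutationCriterion F n 1≤n G isG

criterion-q≡2 : ∀ {c ℓ q₂} (F : FiniteField c ℓ (2 ℕ.+ q₂)) n → 1 ≤ n → (G : Poly F) → IsG F n G → 2 ℕ.+ q₂ ≡ 2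
              → IsPP F G ⇔ FiniteField._≈_ F (seriesCoeff F n) (FiniteField.0# F)
criterion-q≡2 F n 1≤n G isG ≡.refl = mk⇔ IsPP⇒a≈0 a≈0⇒IsPP
  where open PermutationCriterion₂ F n 1≤n G isG

criterion : ∀ {c ℓ} q → 2 ≤ q → (F : FiniteField c ℓ q) → ∀ n → 1 ≤ n → (G : Poly F) → IsG F n G
  → (2 < q → (IsPP F G ⇔ (gcd n (q ∸ 1) ≡ 1 × ¬ (FiniteField._≈_ F (seriesCoeff F n) (FiniteField.0# F)))))
  × (q ≡ 2 → (IsPP F G ⇔ FiniteField._≈_ F (seriesCoeff F n) (FiniteField.0# F)))
criterion (suc (suc q₂)) (s≤s (s≤s z≤n)) F n 1≤n G isG =
  criterion-q>2 F n 1≤n G isG , criterion-q≡2 F n 1≤n G isG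

open import Data.Nat using (_^_)

corollary2p2 : ∀ {c ℓ} (p k : ℕ) → Prime p → 1 ≤ k
    → (F : FiniteField c ℓ (p ^ k)) → (n : ℕ) → 1 ≤ n
    → (G : Poly F) → IsG F n G
    → (2 < p ^ k → (IsPP F G ⇔ ((gcd n (p ^ k ∸ 1) ≡ 1) × ¬ (FiniteField._≈_ F (seriesCoeff F n) (FiniteField.0# F)))))
    × (p ^ k ≡ 2 → (IsPP F G ⇔ FiniteField._≈_ F (seriesCoeff F n) (FiniteField.0# F)))
corollary2p2 p k p-prime 1≤k = criterion (p ^ k) 2≤p^k
  where
  instance
    p-nonTrivial : ℕ.NonTrivial p
    p-nonTrivial = prime⇒nonTrivial p-prime
    p-nonZero : ℕ.NonZero p
    p-nonZero = ℕ.nonTrivial⇒nonZero p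
  2≤p^k : 2 ≤ p ^ k
  2≤p^k = ℕ.≤-trans (ℕ.nonTrivial⇒n>1 p) (≡.subst (_≤ p ^ k) (ℕ.^-identityʳ p) (ℕ.^-monoʳ-≤ p 1≤k))
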